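{- Let $n\ge1$, $1\le i\le n$, $m\ge 1$, and let $Q=(q_{s,t})\in B^{i,m}$ be non-zero. Let $k$ be the smallest row index such that row $k$ of $Q$ is non-zero, let $t^Q$ be the smallest column index $p$ with $q_{p,k}\neq0$, and let $R=(r_{s,t})$ be obtained from $Q$ by replacing all entries of row $k$ by $0$. Define $$H=f_k^{\varphi_k}\circ f_{k-1}^{\varphi_{k-1}}\circ\cdots\circ f_{i+1}^{\varphi_{i+1}},\qquad E=e_i^{\epsilon_i-q_{i,k}}\circ e_{i-1}^{\epsilon_{i-1}-q_{i-1,k}}\circ\cdots\circ e_{t^Q+1}^{\epsilon_{t^Q+1}-q_{t^Q+1,k}},$$ $$F=f_{t^Q}^{q_{t^Q,k}}\circ f_{t^Q+1}^{\varphi_{t^Q+1}}\circ\cdots\circ f_i^{\varphi_i}$$ (a composition with empty index range being the identity). Then $\mathcal K^Q:=H\circ E\circ F$ is defined on $R$ and $\mathcal K^Q(R)=Q$.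
   Context: Fix integers $n\ge1$, $1\le i\le n$, $m\ge 1$. $B^{i,m}$ is the set of arrays $A=(a_{p,q})$ of non-negative integers indexed by $1\le p\le i$, $i\le q\le n$, such that $\sum_{r=1}^n a_{\beta(r)}\le m$ for every Dyck path $\beta$; a Dyck path is a sequence of positions $\beta(1)=(1,i),\dots,\beta(n)=(i,n)$ with $\beta(r+1)\in\{(a,b+1),(a+1,b)\}$ whenever $\beta(r)=(a,b)$. The index $q$ is called the row index and $p$ the column index (row $q$ of $A$ is $(a_{1,q},\dots,a_{i,q})$); set $a_{p,q}=0$ outside this range. $B^{i,m}$ is a crystal with operators, for $\ell\in\{1,\dots,n\}$: (i) $\ell=i$: $\varphi_i(A)=m-\sum_{j=1}^{i-1}a_{j,i}-\sum_{j=i}^n a_{i,j}$, $\epsilon_i(A)=a_{i,i}$; $f_i$ increases $a_{i,i}$ by $1$, $e_i$ decreases it by $1$. (ii) $\ell>i$: for $1\le p\le i$ let $T_p=\sum_{j=1}^p a_{j,\ell-1}+\sum_{j=p}^i a_{j,\ell}$, let $p_+$ (resp. $q_+$) be the smallest (resp. largest) $p$ maximizing $T_p$. Then $\varphi_\ell(A)=\sum_{j=1}^{p_+}a_{j,\ell-1}-\sum_{j=1}^{p_+-1}a_{j,\ell}$, $\epsilon_\ell(A)=\sum_{j=q_+}^i a_{j,\ell}-\sum_{j=q_++1}^i a_{j,\ell-1}$; $f_\ell$ decreases $a_{p_+,\ell-1}$ by 1 and increases $a_{p_+,\ell}$ by 1; $e_\ell$ increases $a_{q_+,\ell-1}$ by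 1 and decreases $a_{q_+,\ell}$ by 1. (iii) $\ell<i$: for $i\le p\le n$ let $U_p=\sum_{j=i}^p a_{\ell,j}+\sum_{j=p}^n a_{\ell+1,j}$, let $p_-$ (resp. $q_-$) be the largest (resp. smallest) $p$ maximizing $U_p$. Then $\varphi_\ell(A)=\sum_{j=p_- }^n a_{\ell+1,j}-\sum_{j=p_-+1}^n a_{\ell,j}$, $\epsilon_\ell(A)=\sum_{j=i}^{q_- }a_{\ell,j}-\sum_{j=i}^{q_--1}a_{\ell+1,j}$; $f_\ell$ increases $a_{\ell,p_- }$ by 1 and decreases $a_{\ell+1,p_- }$ by 1; $e_\ell$ decreases $a_{\ell,q_- }$ by 1 and increases $a_{\ell+1,q_- }$ by 1. In all cases $f_\ell(A)=0$ (undefined) if $\varphi_\ell(A)=0$ and $e_\ell(A)=0$ if $\epsilon_\ell(A)=0$. Operator conventions: $f_j^{\varphi_j}$ applied to an element $B$ means $f_j^{\varphi_j(B)}(B)$; $e_j^{\epsilon_j-c}$ applied to $B$ means $e_j^{\epsilon_j(B)-c}(B)$ (required $c\le\epsilon_j(B)$); $f_j^c$ with a fixed integer $c$ means applying $f_j$ $c$ times; composition $\circ$ is applied right to left. -}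

module Defs where

open import Data.Nat using (ℕ; compare; equal; less; greater; zero; suc; _+_; _∸_; _≤_; _<_; _≡ᵇ_; _<ᵇ_)
open import Data.Bool using (Bool; true; false; if_then_else_; _∧_)
open import Data.List using (List; []; _∷_; map; upTo; reverse)
open import Data.Nat.ListAction using (sum)
open import Data.Product using (_×_)
open import Data.Empty using (⊥)
open import Data.Integer as ℤ using (ℤ; +_; +[1+_]; -[1+_])
open import Data.Maybe using (Maybe; just; nothing; _>>=_)
open import Relation.Binary.PropositionalEquality using (_≡_)

-- Arrays A = (a_{p,q}) : entries a p q (column index p, row index q), 1-based.
Arr : Set
Arr = ℕ → ℕ → ℕ

range : ℕ → ℕ → List ℕ
range a b = map (λ x → a + x) (upTo (suc b ∸ a))

Σ[_⋯_] : ℕ → ℕ → (ℕ → ℕ) → ℕ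
Σ[ a ⋯ b ] f = sum (map f (range a b))

data DyckFrom (i n : ℕ) : ℕ → ℕ → Set where
  stop  : DyckFrom i n i n
  right : ∀ {a b} → DyckFrom i n a (suc b) → DyckFrom i n a b
  down  : ∀ {a b} → DyckFrom i n (suc a) b → DyckFrom i n a b

DyckPath : ℕ → ℕ → Set
DyckPath i n = DyckFrom i n 1 i

pathSum : ∀ {i n a b} → Arr → DyckFrom i n a b → ℕ
pathSum {a = a} {b} A stop      = A a b
pathSum {a = a} {b} A (right β) = A a b + pathSum A β
pathSum {a = a} {b} A (down β)  = A a b + pathSum A β

InRange : ℕ → ℕ → ℕ → ℕ → Set
InRange n i p q = 1 ≤ p × p ≤ i × i ≤ q × q ≤ n

record InB (n i m : ℕ) (A : Arr) : Set where
  field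
    zeroOutside : ∀ p q → (InRange n i p q → ⊥) → A p q ≡ 0
    dyck        : (β : DyckPath i n) → pathSum A β ≤ m

adjust : Arr → ℕ → ℕ → (ℕ → ℕ) → Arr
adjust A p q g p' q' = if (p' ≡ᵇ p) ∧ (q' ≡ᵇ q) then g (A p' q') else A p' q'

inc dec : Arr → ℕ → ℕ → Arr
inc A p q = adjust A p q suc
dec A p q = adjust A p q (λ x → x ∸ 1)

-- smallest / largest maximiser of T over the list best ∷ xs (xs increasing)
argmaxSmallest : (ℕ → ℕ) → ℕ → List ℕ → ℕ
argmaxSmallest T best []       = best
argmaxSmallest T best (x ∷ xs) =
  if T best <ᵇ T x then argmaxSmallest T x xs else argmaxSmallest T best xs

argmaxLargest : (ℕ → ℕ) → ℕ → List ℕ → ℕ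
argmaxLargest T best []       = best
argmaxLargest T best (x ∷ xs) =
  if T x <ᵇ T best then argmaxLargest T best xs else argmaxLargest T x xs

pSmall pLarge : (ℕ → ℕ) → ℕ → ℕ → ℕ
pSmall T a b = argmaxSmallest T a (range (suc a) b)
pLarge T a b = argmaxLargest  T a (range (suc a) b)

_⊖_ : ℕ → ℕ → ℤ
x ⊖ y = (+ x) ℤ.- (+ y)

module Crystal (n i m : ℕ) where

  T : Arr → ℕ → ℕ → ℕ
  T A ℓ p = Σ[ 1 ⋯ p ] (λ j → A j (ℓ ∸ 1)) + Σ[ p ⋯ i ] (λ j → A j ℓ)

  p₊ q₊ : Arr → ℕ → ℕ
  p₊ A ℓ = pSmall (T A ℓ) 1 i
  q₊ A ℓ = pLarge (T A ℓ) 1 i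

  U : Arr → ℕ → ℕ → ℕ
  U A ℓ p = Σ[ i ⋯ p ] (λ j → A ℓ j) + Σ[ p ⋯ n ] (λ j → A (suc ℓ) j)

  p₋ q₋ : Arr → ℕ → ℕ
  p₋ A ℓ = pLarge (U A ℓ) i n
  q₋ A ℓ = pSmall (U A ℓ) i n

  φ : ℕ → Arr → ℤ
  φ ℓ A with compare ℓ i
  ... | equal _ =
        m ⊖ (Σ[ 1 ⋯ i ∸ 1 ] (λ j → A j i) + Σ[ i ⋯ n ] (λ j → A i j))
  ... | greater _ _ = let p = p₊ A ℓ in
        Σ[ 1 ⋯ p ] (λ j → A j (ℓ ∸ 1)) ⊖ Σ[ 1 ⋯ p ∸ 1 ] (λ j → A j ℓ)
  ... | less _ _ = let p = p₋ A ℓ in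
        Σ[ p ⋯ n ] (λ j → A (suc ℓ) j) ⊖ Σ[ suc p ⋯ n ] (λ j → A ℓ j)

  ε : ℕ → Arr → ℤ
  ε ℓ A with compare ℓ i
  ... | equal _ = + A i i
  ... | greater _ _ = let q = q₊ A ℓ in
        Σ[ q ⋯ i ] (λ j → A j ℓ) ⊖ Σ[ suc q ⋯ i ] (λ j → A j (ℓ ∸ 1))
  ... | less _ _ = let q = q₋ A ℓ in
        Σ[ i ⋯ q ] (λ j → A ℓ j) ⊖ Σ[ i ⋯ q ∸ 1 ] (λ j → A (suc ℓ) j)

  -- raw moves (without the definedness test)
  fMove eMove : ℕ → Arr → Arr
  fMove ℓ A with compare ℓ i
  ... | equal _ = inc A i i
  ... | greater _ _ = let p = p₊ A ℓ in inc (dec A p (ℓ ∸ 1)) p ℓ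
  ... | less _ _ = let p = p₋ A ℓ in dec (inc A ℓ p) (suc ℓ) p
  eMove ℓ A with compare ℓ i
  ... | equal _ = dec A i i
  ... | greater _ _ = let q = q₊ A ℓ in dec (inc A q (ℓ ∸ 1)) q ℓ
  ... | less _ _ = let q = q₋ A ℓ in inc (dec A ℓ q) (suc ℓ) q

  -- f_ℓ, e_ℓ : partial (nothing = "0", undefined) when φ_ℓ (resp. ε_ℓ) is 0
  -- (tested as ≤ 0, which is the same on B^{i,m} where φ, ε ≥ 0)
  positive : ℤ → Bool
  positive +[1+ _ ] = true
  positive _        = false

  f e : ℕ → Arr → Maybe Arr
  f ℓ A = if positive (φ ℓ A) then just (fMove ℓ A) else nothing
  e ℓ A = if positive (ε ℓ A) then just (eMove ℓ A) else nothing

  iter : (Arr → Maybe Arr) → ℕ → Arr → Maybe Arr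
  iter g zero    A = just A
  iter g (suc c) A = g A >>= iter g c

  iterℤ : (Arr → Maybe Arr) → ℤ → Arr → Maybe Arr
  iterℤ g (+ c)      A = iter g c A
  iterℤ g -[1+ _ ]   A = nothing

  fφ : ℕ → Arr → Maybe Arr
  fφ j A = iterℤ (f j) (φ j A) A

  eε- : ℕ → ℕ → Arr → Maybe Arr
  eε- j c A = iterℤ (e j) (ε j A ℤ.- + c) A

upSeq : ℕ → ℕ → (ℕ → Arr → Maybe Arr) → Arr → Maybe Arr
upSeq a b g A = go (range a b) A
  where
    go : List ℕ → Arr → Maybe Arr
    go []       A = just A
    go (x ∷ xs) A = g x A >>= go xs

downSeq : ℕ → ℕ → (ℕ → Arr → Maybe Arr) → Arr → Maybe Arr
downSeq a b g A = go (reverse (range a b)) A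
  where
    go : List ℕ → Arr → Maybe Arr
    go []       A = just A
    go (x ∷ xs) A = g x A >>= go xs

module _ (n i m : ℕ) (Q : Arr) (k t : ℕ) where
  open Crystal n i m

  Hmap : Arr → Maybe Arr
  Hmap = upSeq (suc i) k fφ

  Emap : Arr → Maybe Arr
  Emap = upSeq (suc t) i (λ j → eε- j (Q j k))

  -- F = f_t^{q_{t,k}} ∘ f_{t+1}^{φ_{t+1}} ∘ ⋯ ∘ f_i^{φ_i}  (f_i first)
  Fmap : Arr → Maybe Arr
  Fmap A = downSeq (suc t) i fφ A >>= iter (f t) (Q t k)

  Kmap : Arr → Maybe Arr
  Kmap A = Fmap A >>= Emap >>= Hmap

zeroRow : Arr → ℕ → Arr
zeroRow Q k p q = if q ≡ᵇ k then 0 else Q p q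

{-# OPTIONS --safe #-}
module Submission where

open import Defs
open import Data.Nat
open import Data.Nat.Properties
open import Data.Nat.ListAction using (sum)
open import Data.Nat.Tactic.RingSolver using (solve-∀)
open import Algebra.Properties.CommutativeSemigroup +-commutativeSemigroup using (xy∙z≈xz∙y; x∙yz≈xz∙y)
open import Data.Bool using (true; false; if_then_else_) renaming (T to Tᵇ)
open import Data.Integer as ℤ using ()
import Data.Integer.Properties as ℤᵖ
open import Data.Maybe using (Maybe; just; nothing; _>>=_)
open import Data.List using (List; []; _∷_; _++_; map; applyUpTo; reverse)
open import Data.List.Properties using (map-upTo; reverse-++)
open import Data.Product using (Σ; ∃; _×_; _,_; proj₁; proj₂)
open import Data.Sum using (_⊎_; inj₁; inj₂; [_,_]′)
open import Data.Empty using (⊥-elim)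
open import Function using (_∘_)
open import Relation.Nullary using (¬_; yes; no)
open import Relation.Binary.Definitions using (tri<; tri≈; tri>)
open import Relation.Binary.PropositionalEquality

-- The operators f_ℓ, e_ℓ with ℓ < i act on the column pair (ℓ, ℓ + 1) by the signature rule: f_ℓ moves a unit
-- from column ℓ + 1 to column ℓ in the row where U_p is largest, e_ℓ moves one back, and neither notices units
-- added at the top entry (ℓ, i).  Regroup E ∘ F into nested layers, the layer of column j being f_j^{φ_j}, then
-- the layers of the columns left of j, then e_j^{ε_j − q_{j,k}}.  When it starts, column j + 1 has sum m, and the
-- Dyck condition on Q, for paths running along row k through the columns 1, …, j, makes U_i exceed every other
-- U_y by at least S_j = q_{1,k} + ⋯ + q_{j,k}.  So the first S_j moves of f_j fill (j, i); the inner layers take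
-- S_{j−1} of these units away, and e_j then undoes exactly the other moves of f_j.  The layer thus leaves q_{j,k}
-- at (j, i) and S_j fewer units at (j + 1, i).  At column i, f_i fills (i, i) up to the bound m and e_i removes
-- all but q_{i,k}, so E ∘ F rebuilds row k of Q in row i.  Finally, as rows i + 1, …, k are empty, each
-- f_ℓ^{φ_ℓ} of H moves the whole row ℓ − 1 down to row ℓ.

-- Sums over intervals

countUp : ℕ → ℕ → List ℕ
countUp a zero    = []
countUp a (suc l) = a ∷ countUp (suc a) l

sumFrom : (ℕ → ℕ) → ℕ → ℕ → ℕ
sumFrom f a zero    = 0
sumFrom f a (suc l) = f a + sumFrom f (suc a) l

range-countUp : ∀ a b → range a b ≡ countUp a (suc b ∸ a)
range-countUp a b = trans (map-upTo (a +_) (suc b ∸ a)) (applyUpTo-countUp (a +_) a (suc b ∸ a) (λ _ → refl))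
  where
    applyUpTo-countUp : ∀ (h : ℕ → ℕ) a l → (∀ x → h x ≡ a + x) → applyUpTo h l ≡ countUp a l
    applyUpTo-countUp h a zero    _  = refl
    applyUpTo-countUp h a (suc l) eq =
      cong₂ _∷_ (trans (eq 0) (+-identityʳ a))
                (applyUpTo-countUp (h ∘ suc) (suc a) l (λ x → trans (eq (suc x)) (+-suc a x)))

countUp-suc : ∀ a d → countUp a (suc d) ≡ countUp a d ++ (d + a ∷ [])
countUp-suc a zero    = refl
countUp-suc a (suc d) = cong (a ∷_) (trans (countUp-suc (suc a) d) (cong (λ x → countUp (suc a) d ++ (x ∷ [])) (+-suc d a)))

Σ-sumFrom : ∀ a b f → Σ[ a ⋯ b ] f ≡ sumFrom f a (suc b ∸ a)
Σ-sumFrom a b f = trans (cong (sum ∘ map f) (range-countUp a b)) (sum-countUp a (suc b ∸ a))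
  where
    sum-countUp : ∀ a l → sum (map f (countUp a l)) ≡ sumFrom f a l
    sum-countUp a zero    = refl
    sum-countUp a (suc l) = cong (f a +_) (sum-countUp (suc a) l)

module _ (f : ℕ → ℕ) where

  sumFrom-+ : ∀ a l₁ l₂ → sumFrom f a (l₁ + l₂) ≡ sumFrom f a l₁ + sumFrom f (l₁ + a) l₂
  sumFrom-+ a zero     l₂ = refl
  sumFrom-+ a (suc l₁) l₂ = begin
    f a + sumFrom f (suc a) (l₁ + l₂)                              ≡⟨ cong (f a +_) (sumFrom-+ (suc a) l₁ l₂) ⟩
    f a + (sumFrom f (suc a) l₁ + sumFrom f (l₁ + suc a) l₂)       ≡⟨ sym (+-assoc (f a) _ _) ⟩
    f a + sumFrom f (suc a) l₁ + sumFrom f (l₁ + suc a) l₂         ≡⟨ cong (λ c → f a + sumFrom f (suc a) l₁ + sumFrom f c l₂) (+-suc l₁ a) ⟩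
    f a + sumFrom f (suc a) l₁ + sumFrom f (suc l₁ + a) l₂         ∎
    where open ≡-Reasoning

  private
    shift : ∀ {a l x} → x < suc a + l → x < a + suc l
    shift {a} {l} {x} = subst (x <_) (sym (+-suc a l))

    here< : ∀ a l → a < a + suc l
    here< a l = shift (s≤s (m≤m+n a l))

    empty-range : ∀ {a x} → a ≤ x → x < a + 0 → ∀ {P : Set} → P
    empty-range {a} a≤x x<a = ⊥-elim (<-irrefl refl (<-≤-trans x<a (subst (_≤ _) (sym (+-identityʳ a)) a≤x)))

  sumFrom-cong : ∀ {g} a l → (∀ x → a ≤ x → x < a + l → f x ≡ g x) → sumFrom f a l ≡ sumFrom g a l
  sumFrom-cong a zero    eq = refl
  sumFrom-cong a (suc l) eq =
    cong₂ _+_ (eq a ≤-refl (here< a l)) (sumFrom-cong (suc a) l (λ x a<x x<b → eq x (<⇒≤ a<x) (shift x<b)))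

  sumFrom-term : ∀ a l x → a ≤ x → x < a + l → f x ≤ sumFrom f a l
  sumFrom-term a zero    x a≤x x<b = empty-range a≤x x<b
  sumFrom-term a (suc l) x a≤x x<b with m≤n⇒m<n∨m≡n a≤x
  ... | inj₂ refl = m≤m+n (f a) _
  ... | inj₁ a<x  = ≤-trans (sumFrom-term (suc a) l x a<x (subst (x <_) (+-suc a l) x<b)) (m≤n+m _ (f a))

  sumFrom-suc : ∀ {g} a l x → a ≤ x → x < a + l → g x ≡ suc (f x) → (∀ y → y ≢ x → g y ≡ f y) →
                sumFrom g a l ≡ suc (sumFrom f a l)
  sumFrom-suc a zero    x a≤x x<b _  _  = empty-range a≤x x<b
  sumFrom-suc {g} a (suc l) x a≤x x<b gx gy with m≤n⇒m<n∨m≡n a≤x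
  ... | inj₂ refl = cong₂ _+_ gx (sym (sumFrom-cong (suc a) l (λ y a<y _ → sym (gy y (>⇒≢ a<y)))))
  ... | inj₁ a<x  = trans (cong₂ _+_ (gy a (<⇒≢ a<x)) (sumFrom-suc (suc a) l x a<x (subst (x <_) (+-suc a l) x<b) gx gy))
                          (+-suc (f a) _)

  sumFrom-≡0 : ∀ a l → (∀ x → a ≤ x → x < a + l → f x ≡ 0) → sumFrom f a l ≡ 0
  sumFrom-≡0 a zero    _  = refl
  sumFrom-≡0 a (suc l) eq = cong₂ _+_ (eq a ≤-refl (here< a l)) (sumFrom-≡0 (suc a) l (λ x a<x x<b → eq x (<⇒≤ a<x) (shift x<b)))

sumFrom-last : ∀ f a l → sumFrom f a (suc l) ≡ sumFrom f a l + f (l + a)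
sumFrom-last f a l = trans (cong (sumFrom f a) (+-comm 1 l)) (trans (sumFrom-+ f a l 1) (cong (sumFrom f a l +_) (+-identityʳ _)))

private
  <-length⇒≤ : ∀ {a b x} → a ≤ x → x < a + (suc b ∸ a) → x ≤ b
  <-length⇒≤ {a} {b} {x} a≤x x<b with a ≤? suc b
  ... | yes a≤b = ≤-pred (subst (x <_) (m+[n∸m]≡n a≤b) x<b)
  ... | no  a≰b = ⊥-elim (<-irrefl refl (≤-<-trans a≤x (subst (x <_) a+0≡a x<b)))
    where a+0≡a = trans (cong (a +_) (m≤n⇒m∸n≡0 (<⇒≤ (≰⇒> a≰b)))) (+-identityʳ a)

  ≤⇒<-length : ∀ {a b x} → a ≤ x → x ≤ b → x < a + (suc b ∸ a)
  ≤⇒<-length {a} {b} {x} a≤x x≤b = subst (x <_) (sym (m+[n∸m]≡n (≤-trans a≤x (m≤n⇒m≤1+n x≤b)))) (s≤s x≤b)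

module _ (a b : ℕ) (f : ℕ → ℕ) where

  Σ-cong : ∀ {g} → (∀ x → a ≤ x → x ≤ b → f x ≡ g x) → Σ[ a ⋯ b ] f ≡ Σ[ a ⋯ b ] g
  Σ-cong {g} eq = begin
    Σ[ a ⋯ b ] f                 ≡⟨ Σ-sumFrom a b f ⟩
    sumFrom f a (suc b ∸ a)      ≡⟨ sumFrom-cong f a _ (λ x a≤x x<b → eq x a≤x (<-length⇒≤ a≤x x<b)) ⟩
    sumFrom g a (suc b ∸ a)      ≡⟨ Σ-sumFrom a b g ⟨
    Σ[ a ⋯ b ] g                 ∎
    where open ≡-Reasoning

  Σ-≡0 : (∀ x → a ≤ x → x ≤ b → f x ≡ 0) → Σ[ a ⋯ b ] f ≡ 0
  Σ-≡0 eq = trans (Σ-sumFrom a b f) (sumFrom-≡0 f a _ (λ x a≤x x<b → eq x a≤x (<-length⇒≤ a≤x x<b)))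

  term≤Σ : ∀ x → a ≤ x → x ≤ b → f x ≤ Σ[ a ⋯ b ] f
  term≤Σ x a≤x x≤b = subst (f x ≤_) (sym (Σ-sumFrom a b f)) (sumFrom-term f a _ x a≤x (≤⇒<-length a≤x x≤b))

  Σ≡0⇒term≡0 : Σ[ a ⋯ b ] f ≡ 0 → ∀ x → a ≤ x → x ≤ b → f x ≡ 0
  Σ≡0⇒term≡0 eq x a≤x x≤b = n≤0⇒n≡0 (subst (f x ≤_) eq (term≤Σ x a≤x x≤b))

  Σ-suc : ∀ {g} x → a ≤ x → x ≤ b → g x ≡ suc (f x) → (∀ y → y ≢ x → g y ≡ f y) → Σ[ a ⋯ b ] g ≡ suc (Σ[ a ⋯ b ] f)
  Σ-suc {g} x a≤x x≤b gx gy = begin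
    Σ[ a ⋯ b ] g                   ≡⟨ Σ-sumFrom a b g ⟩
    sumFrom g a (suc b ∸ a)        ≡⟨ sumFrom-suc f a _ x a≤x (≤⇒<-length a≤x x≤b) gx gy ⟩
    suc (sumFrom f a (suc b ∸ a))  ≡⟨ cong suc (Σ-sumFrom a b f) ⟨
    suc (Σ[ a ⋯ b ] f)             ∎
    where open ≡-Reasoning

  Σ-empty : b < a → Σ[ a ⋯ b ] f ≡ 0
  Σ-empty b<a = trans (Σ-sumFrom a b f) (cong (sumFrom f a) (m≤n⇒m∸n≡0 b<a))

Σ-split : ∀ a c b f → a ≤ suc c → c ≤ b → Σ[ a ⋯ b ] f ≡ Σ[ a ⋯ c ] f + Σ[ suc c ⋯ b ] f
Σ-split a c b f a≤c c≤b = begin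
  Σ[ a ⋯ b ] f                                             ≡⟨ Σ-sumFrom a b f ⟩
  sumFrom f a (suc b ∸ a)                                  ≡⟨ cong (sumFrom f a) length-split ⟩
  sumFrom f a ((suc c ∸ a) + (b ∸ c))                      ≡⟨ sumFrom-+ f a (suc c ∸ a) (b ∸ c) ⟩
  sumFrom f a (suc c ∸ a) + sumFrom f (suc c ∸ a + a) (b ∸ c) ≡⟨ cong (λ d → sumFrom f a (suc c ∸ a) + sumFrom f d (b ∸ c)) (m∸n+n≡m a≤c) ⟩
  sumFrom f a (suc c ∸ a) + sumFrom f (suc c) (b ∸ c)      ≡⟨ cong₂ _+_ (Σ-sumFrom a c f) (Σ-sumFrom (suc c) b f) ⟨
  Σ[ a ⋯ c ] f + Σ[ suc c ⋯ b ] f                          ∎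
  where
    open ≡-Reasoning
    length-split : suc b ∸ a ≡ (suc c ∸ a) + (b ∸ c)
    length-split = trans (cong (λ d → suc d ∸ a) (sym (m+[n∸m]≡n c≤b))) (+-∸-comm (b ∸ c) a≤c)

Σ-single : ∀ a f → Σ[ a ⋯ a ] f ≡ f a
Σ-single a f = trans (Σ-sumFrom a a f) (trans (cong (sumFrom f a) (m+n∸n≡m 1 a)) (+-identityʳ (f a)))

Σ-first : ∀ a b f → a ≤ b → Σ[ a ⋯ b ] f ≡ f a + Σ[ suc a ⋯ b ] f
Σ-first a b f a≤b = trans (Σ-split a a b f (n≤1+n a) a≤b) (cong (_+ Σ[ suc a ⋯ b ] f) (Σ-single a f))

Σ-last : ∀ a b f → a ≤ suc b → Σ[ a ⋯ suc b ] f ≡ Σ[ a ⋯ b ] f + f (suc b)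
Σ-last a b f a≤b = trans (Σ-split a b (suc b) f a≤b (n≤1+n b)) (cong (Σ[ a ⋯ b ] f +_) (Σ-single (suc b) f))

Σ-sumFrom-last : ∀ a b f → a ≤ b → Σ[ a ⋯ b ] f ≡ sumFrom f a (b ∸ a) + f b
Σ-sumFrom-last a b f a≤b = begin
  Σ[ a ⋯ b ] f                        ≡⟨ Σ-sumFrom a b f ⟩
  sumFrom f a (suc b ∸ a)             ≡⟨ cong (sumFrom f a) (+-∸-assoc 1 a≤b) ⟩
  sumFrom f a (suc (b ∸ a))           ≡⟨ sumFrom-last f a (b ∸ a) ⟩
  sumFrom f a (b ∸ a) + f (b ∸ a + a) ≡⟨ cong (λ x → sumFrom f a (b ∸ a) + f x) (m∸n+n≡m a≤b) ⟩
  sumFrom f a (b ∸ a) + f b           ∎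
  where open ≡-Reasoning

Σ-prefix-mono : ∀ (f : ℕ → ℕ) {a b} → a ≤ b → Σ[ 1 ⋯ a ] f ≤ Σ[ 1 ⋯ b ] f
Σ-prefix-mono f {a} {b} a≤b = subst (Σ[ 1 ⋯ a ] f ≤_) (sym (Σ-split 1 a b f (s≤s z≤n) a≤b)) (m≤m+n _ _)

Σ-suffix-antitone : ∀ (f : ℕ → ℕ) c {a b} → a ≤ b → Σ[ b ⋯ c ] f ≤ Σ[ a ⋯ c ] f
Σ-suffix-antitone f c {b = zero}  z≤n = ≤-refl
Σ-suffix-antitone f c {a} {suc b} a≤b with m≤n⇒m<n∨m≡n a≤b
... | inj₂ refl = ≤-refl
... | inj₁ a<b  = ≤-trans drop-first (Σ-suffix-antitone f c (≤-pred a<b))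
  where
    drop-first : Σ[ suc b ⋯ c ] f ≤ Σ[ b ⋯ c ] f
    drop-first with b ≤? c
    ... | yes b≤c = subst (Σ[ suc b ⋯ c ] f ≤_) (sym (Σ-first b c f b≤c)) (m≤n+m _ _)
    ... | no  b≰c = subst (_≤ Σ[ b ⋯ c ] f) (sym (Σ-empty (suc b) c f (≤-trans (≰⇒> b≰c) (n≤1+n b)))) z≤n

record LastPositive (f : ℕ → ℕ) (c x : ℕ) : Set where
  field
    1≤x       : 1 ≤ x
    x≤c       : x ≤ c
    f>0       : 0 < f x
    zeroAfter : ∀ y → x < y → y ≤ c → f y ≡ 0

lastPositive : ∀ f c → 0 < Σ[ 1 ⋯ c ] f → ∃ (LastPositive f c)
lastPositive f zero    pos = ⊥-elim (<-irrefl (sym (Σ-empty 1 0 f z<s)) pos)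
lastPositive f (suc c) pos with f (suc c) in fc
... | suc _ = suc c , record { 1≤x = s≤s z≤n ; x≤c = ≤-refl ; f>0 = subst (0 <_) (sym fc) z<s
                             ; zeroAfter = λ y c<y y≤c → ⊥-elim (<-irrefl refl (<-≤-trans c<y y≤c)) }
... | zero with lastPositive f c (subst (0 <_) (trans (Σ-last 1 c f (s≤s z≤n)) (trans (cong (Σ[ 1 ⋯ c ] f +_) fc) (+-identityʳ _))) pos)
... | x , lp = x , record { 1≤x = 1≤x ; x≤c = m≤n⇒m≤1+n x≤c ; f>0 = f>0 ; zeroAfter = zeroAfter′ }
  where
    open LastPositive lp
    zeroAfter′ : ∀ y → x < y → y ≤ suc c → f y ≡ 0
    zeroAfter′ y x<y y≤c with m≤n⇒m<n∨m≡n y≤c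
    ... | inj₁ y<c  = zeroAfter y x<y (≤-pred y<c)
    ... | inj₂ refl = fc

-- First and last maximisers

record IsFirstMax (T : ℕ → ℕ) (a b r : ℕ) : Set where
  field
    lower   : a ≤ r
    upper   : r ≤ b
    maximal : ∀ y → a ≤ y → y ≤ b → T y ≤ T r
    before  : ∀ y → a ≤ y → y < r → T y < T r

record IsLastMax (T : ℕ → ℕ) (a b r : ℕ) : Set where
  field
    lower   : a ≤ r
    upper   : r ≤ b
    maximal : ∀ y → a ≤ y → y ≤ b → T y ≤ T r
    after   : ∀ y → r < y → y ≤ b → T y < T r

private
  <ᵇ-true : ∀ {x y} → (x <ᵇ y) ≡ true → x < y
  <ᵇ-true {x} {y} e = <ᵇ⇒< x y (subst Tᵇ (sym e) _)

  <ᵇ-false : ∀ {x y} → (x <ᵇ y) ≡ false → y ≤ x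
  <ᵇ-false {x} {y} e = ≮⇒≥ (λ x<y → subst Tᵇ e (<⇒<ᵇ x<y))

module _ {T : ℕ → ℕ} {a b r : ℕ} where

  private
    at-suc : ∀ (P : ℕ → Set) {y} → y ≤ suc b → (y ≤ b → P y) → P (suc b) → P y
    at-suc P y≤b old new with m≤n⇒m<n∨m≡n y≤b
    ... | inj₁ y<b  = old (≤-pred y<b)
    ... | inj₂ refl = new

  IsFirstMax-keep : IsFirstMax T a b r → T (suc b) ≤ T r → IsFirstMax T a (suc b) r
  IsFirstMax-keep m ≤r = record
    { lower = lower ; upper = m≤n⇒m≤1+n upper ; before = before
    ; maximal = λ y a≤y y≤b → at-suc (λ y → T y ≤ T _) y≤b (maximal y a≤y) ≤r }
    where open IsFirstMax m

  IsFirstMax-new : IsFirstMax T a b r → T r < T (suc b) → IsFirstMax T a (suc b) (suc b)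
  IsFirstMax-new m r< = record
    { lower = ≤-trans lower (m≤n⇒m≤1+n upper) ; upper = ≤-refl
    ; maximal = λ y a≤y y≤b → at-suc (λ y → T y ≤ T _) y≤b (λ y≤b → <⇒≤ (≤-<-trans (maximal y a≤y y≤b) r<)) ≤-refl
    ; before  = λ y a≤y y<b → ≤-<-trans (maximal y a≤y (≤-pred y<b)) r< }
    where open IsFirstMax m

  IsLastMax-keep : IsLastMax T a b r → T (suc b) < T r → IsLastMax T a (suc b) r
  IsLastMax-keep m <r = record
    { lower = lower ; upper = m≤n⇒m≤1+n upper
    ; maximal = λ y a≤y y≤b → at-suc (λ y → T y ≤ T _) y≤b (maximal y a≤y) (<⇒≤ <r)
    ; after   = λ y r<y y≤b → at-suc (λ y → T y < T r) y≤b (after y r<y) <r }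
    where open IsLastMax m

  IsLastMax-new : IsLastMax T a b r → T r ≤ T (suc b) → IsLastMax T a (suc b) (suc b)
  IsLastMax-new m r≤ = record
    { lower = ≤-trans lower (m≤n⇒m≤1+n upper) ; upper = ≤-refl
    ; maximal = λ y a≤y y≤b → at-suc (λ y → T y ≤ T _) y≤b (λ y≤b → ≤-trans (maximal y a≤y y≤b) r≤) ≤-refl
    ; after   = λ y b<y y≤b → ⊥-elim (<-irrefl refl (<-≤-trans b<y y≤b)) }
    where open IsLastMax m

private
  singleton-first : ∀ T a → IsFirstMax T a a a
  singleton-first T a = record
    { lower = ≤-refl ; upper = ≤-refl
    ; maximal = λ y a≤y y≤a → ≤-reflexive (cong T (≤-antisym y≤a a≤y))
    ; before = λ y a≤y y<a → ⊥-elim (<-irrefl refl (<-≤-trans y<a a≤y)) }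

  singleton-last : ∀ T a → IsLastMax T a a a
  singleton-last T a = record
    { lower = ≤-refl ; upper = ≤-refl
    ; maximal = λ y a≤y y≤a → ≤-reflexive (cong T (≤-antisym y≤a a≤y))
    ; after = λ y a<y y≤a → ⊥-elim (<-irrefl refl (<-≤-trans a<y y≤a)) }

  scan-first : ∀ T {a b r} l → IsFirstMax T a b r → IsFirstMax T a (l + b) (argmaxSmallest T r (countUp (suc b) l))
  scan-first T zero    m = m
  scan-first T {a} {b} {r} (suc l) m with T r <ᵇ T (suc b) in eq
  ... | true  = subst (motive (suc b)) (+-suc l b) (scan-first T l (IsFirstMax-new m (<ᵇ-true eq)))
    where motive = λ r c → IsFirstMax T a c (argmaxSmallest T r (countUp (suc (suc b)) l))
  ... | false = subst (motive r) (+-suc l b) (scan-first T l (IsFirstMax-keep m (<ᵇ-false eq)))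
    where motive = λ r c → IsFirstMax T a c (argmaxSmallest T r (countUp (suc (suc b)) l))

  scan-last : ∀ T {a b r} l → IsLastMax T a b r → IsLastMax T a (l + b) (argmaxLargest T r (countUp (suc b) l))
  scan-last T zero    m = m
  scan-last T {a} {b} {r} (suc l) m with T (suc b) <ᵇ T r in eq
  ... | true  = subst (motive r) (+-suc l b) (scan-last T l (IsLastMax-keep m (<ᵇ-true eq)))
    where motive = λ r c → IsLastMax T a c (argmaxLargest T r (countUp (suc (suc b)) l))
  ... | false = subst (motive (suc b)) (+-suc l b) (scan-last T l (IsLastMax-new m (<ᵇ-false eq)))
    where motive = λ r c → IsLastMax T a c (argmaxLargest T r (countUp (suc (suc b)) l))

pSmall-isFirstMax : ∀ T a b → a ≤ b → IsFirstMax T a b (pSmall T a b)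
pSmall-isFirstMax T a b a≤b rewrite range-countUp (suc a) b =
  subst (λ c → IsFirstMax T a c (argmaxSmallest T a (countUp (suc a) (b ∸ a)))) (m∸n+n≡m a≤b) (scan-first T (b ∸ a) (singleton-first T a))

pLarge-isLastMax : ∀ T a b → a ≤ b → IsLastMax T a b (pLarge T a b)
pLarge-isLastMax T a b a≤b rewrite range-countUp (suc a) b =
  subst (λ c → IsLastMax T a c (argmaxLargest T a (countUp (suc a) (b ∸ a)))) (m∸n+n≡m a≤b) (scan-last T (b ∸ a) (singleton-last T a))

IsFirstMax-unique : ∀ {T a b r r′} → IsFirstMax T a b r → IsFirstMax T a b r′ → r ≡ r′
IsFirstMax-unique {r = r} {r′} m m′ with <-cmp r r′
... | tri< r<r′ _ _ = ⊥-elim (<-irrefl refl (<-≤-trans (M′.before r M.lower r<r′) (M.maximal _ M′.lower M′.upper)))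
  where
    module M = IsFirstMax m
    module M′ = IsFirstMax m′
... | tri≈ _ r≡r′ _ = r≡r′
... | tri> _ _ r′<r = ⊥-elim (<-irrefl refl (<-≤-trans (M.before r′ M′.lower r′<r) (M′.maximal _ M.lower M.upper)))
  where
    module M = IsFirstMax m
    module M′ = IsFirstMax m′

IsLastMax-unique : ∀ {T a b r r′} → IsLastMax T a b r → IsLastMax T a b r′ → r ≡ r′
IsLastMax-unique {r = r} {r′} m m′ with <-cmp r r′
... | tri< r<r′ _ _ = ⊥-elim (<-irrefl refl (<-≤-trans (M.after r′ r<r′ M′.upper) (M′.maximal _ M.lower M.upper)))
  where
    module M = IsLastMax m
    module M′ = IsLastMax m′
... | tri≈ _ r≡r′ _ = r≡r′
... | tri> _ _ r′<r = ⊥-elim (<-irrefl refl (<-≤-trans (M′.after r r′<r M.upper) (M.maximal _ M′.lower M′.upper)))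
  where
    module M = IsLastMax m
    module M′ = IsLastMax m′

pSmall-unique : ∀ {T a b r} → IsFirstMax T a b r → pSmall T a b ≡ r
pSmall-unique {T} {a} {b} m = IsFirstMax-unique (pSmall-isFirstMax T a b (≤-trans lower upper)) m
  where open IsFirstMax m

pLarge-unique : ∀ {T a b r} → IsLastMax T a b r → pLarge T a b ≡ r
pLarge-unique {T} {a} {b} m = IsLastMax-unique (pLarge-isLastMax T a b (≤-trans lower upper)) m
  where open IsLastMax m

module _ {T T′ : ℕ → ℕ} {a b : ℕ} (d : ℕ) (shifted : ∀ y → a ≤ y → y ≤ b → T′ y ≡ T y + d) where

  IsFirstMax-shift : ∀ {r} → IsFirstMax T a b r → IsFirstMax T′ a b r
  IsFirstMax-shift m = record
    { lower = lower ; upper = upper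
    ; maximal = λ y a≤y y≤b → subst₂ _≤_ (sym (shifted y a≤y y≤b)) (sym (shifted _ lower upper)) (+-monoˡ-≤ d (maximal y a≤y y≤b))
    ; before  = λ y a≤y y<r → subst₂ _<_ (sym (shifted y a≤y (<⇒≤ (<-≤-trans y<r upper)))) (sym (shifted _ lower upper))
                                      (+-monoˡ-< d (before y a≤y y<r)) }
    where open IsFirstMax m

  IsLastMax-shift : ∀ {r} → IsLastMax T a b r → IsLastMax T′ a b r
  IsLastMax-shift m = record
    { lower = lower ; upper = upper
    ; maximal = λ y a≤y y≤b → subst₂ _≤_ (sym (shifted y a≤y y≤b)) (sym (shifted _ lower upper)) (+-monoˡ-≤ d (maximal y a≤y y≤b))
    ; after   = λ y r<y y≤b → subst₂ _<_ (sym (shifted y (≤-trans lower (<⇒≤ r<y)) y≤b)) (sym (shifted _ lower upper))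
                                      (+-monoˡ-< d (after y r<y y≤b)) }
    where open IsLastMax m

  pSmall-shift : a ≤ b → pSmall T′ a b ≡ pSmall T a b
  pSmall-shift a≤b = pSmall-unique (IsFirstMax-shift (pSmall-isFirstMax T a b a≤b))

  pLarge-shift : a ≤ b → pLarge T′ a b ≡ pLarge T a b
  pLarge-shift a≤b = pLarge-unique (IsLastMax-shift (pLarge-isLastMax T a b a≤b))

-- Arrays and unit moves

infix 4 _≋_
_≋_ : Arr → Arr → Set
A ≋ B = ∀ p q → A p q ≡ B p q

≡ᵇ-refl : ∀ p → (p ≡ᵇ p) ≡ true
≡ᵇ-refl zero    = refl
≡ᵇ-refl (suc p) = ≡ᵇ-refl p

≢⇒≡ᵇ-false : ∀ p q → p ≢ q → (p ≡ᵇ q) ≡ false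
≢⇒≡ᵇ-false p q p≢q with p ≡ᵇ q in eq
... | true  = ⊥-elim (p≢q (≡ᵇ⇒≡ p q (subst Tᵇ (sym eq) _)))
... | false = refl

module _ (A : Arr) (p q : ℕ) (g : ℕ → ℕ) where

  adjust-here : adjust A p q g p q ≡ g (A p q)
  adjust-here rewrite ≡ᵇ-refl p | ≡ᵇ-refl q = refl

  adjust-otherCol : ∀ p′ q′ → p′ ≢ p → adjust A p q g p′ q′ ≡ A p′ q′
  adjust-otherCol p′ q′ p′≢p rewrite ≢⇒≡ᵇ-false p′ p p′≢p = refl

  adjust-otherRow : ∀ p′ q′ → q′ ≢ q → adjust A p q g p′ q′ ≡ A p′ q′
  adjust-otherRow p′ q′ q′≢q rewrite ≢⇒≡ᵇ-false q′ q q′≢q with p′ ≡ᵇ p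
  ... | true  = refl
  ... | false = refl

record ColumnMove (A C : Arr) (src dst q : ℕ) : Set where
  field
    dst-suc   : C dst q ≡ suc (A dst q)
    src-suc   : A src q ≡ suc (C src q)
    dst-other : ∀ y → y ≢ q → C dst y ≡ A dst y
    src-other : ∀ y → y ≢ q → C src y ≡ A src y
    elsewhere : ∀ x y → x ≢ src → x ≢ dst → C x y ≡ A x y

record RowMove (A C : Arr) (x r₁ r₂ : ℕ) : Set where
  field
    dst-suc   : C x r₂ ≡ suc (A x r₂)
    src-suc   : A x r₁ ≡ suc (C x r₁)
    otherRow  : ∀ y → y ≢ r₁ → y ≢ r₂ → C x y ≡ A x y
    otherCol  : ∀ x′ y → x′ ≢ x → C x′ y ≡ A x′ y

agree-split : ∀ a {F G : ℕ → ℕ} → F a ≡ G a → (∀ x → x ≢ a → F x ≡ G x) → ∀ x → F x ≡ G x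
agree-split a at off x with x ≟ a
... | yes refl = at
... | no  x≢a  = off x x≢a

agree-split₂ : ∀ a b {F G : ℕ → ℕ} → F a ≡ G a → F b ≡ G b → (∀ x → x ≢ a → x ≢ b → F x ≡ G x) → ∀ x → F x ≡ G x
agree-split₂ a b at-a at-b off x with x ≟ a | x ≟ b
... | yes refl | _        = at-a
... | no _     | yes refl = at-b
... | no x≢a   | no x≢b   = off x x≢a x≢b

private
  pred-suc : ∀ {a} → 0 < a → a ≡ suc (a ∸ 1)
  pred-suc {suc _} _ = refl

module _ (A : Arr) (src dst q : ℕ) (src≢dst : src ≢ dst) (pos : 0 < A src q) where

  private
    dst≢src = λ e → src≢dst (sym e)

  inc-dec-columnMove : ColumnMove A (dec (inc A dst q) src q) src dst q
  inc-dec-columnMove = record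
    { dst-suc   = trans (adjust-otherCol B src q (_∸ 1) dst q dst≢src) (adjust-here A dst q suc)
    ; src-suc   = trans (pred-suc pos) (cong suc (sym (trans (adjust-here B src q (_∸ 1)) (cong (_∸ 1) (adjust-otherCol A dst q suc src q src≢dst)))))
    ; dst-other = λ y y≢q → trans (adjust-otherCol B src q (_∸ 1) dst y dst≢src) (adjust-otherRow A dst q suc dst y y≢q)
    ; src-other = λ y y≢q → trans (adjust-otherRow B src q (_∸ 1) src y y≢q) (adjust-otherCol A dst q suc src y src≢dst)
    ; elsewhere = λ x y x≢s x≢d → trans (adjust-otherCol B src q (_∸ 1) x y x≢s) (adjust-otherCol A dst q suc x y x≢d) }
    where
      B = inc A dst q

  dec-inc-columnMove : ColumnMove A (inc (dec A src q) dst q) src dst q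
  dec-inc-columnMove = record
    { dst-suc   = trans (adjust-here B dst q suc) (cong suc (adjust-otherCol A src q (_∸ 1) dst q dst≢src))
    ; src-suc   = trans (pred-suc pos) (cong suc (sym (trans (adjust-otherCol B dst q suc src q src≢dst) (adjust-here A src q (_∸ 1)))))
    ; dst-other = λ y y≢q → trans (adjust-otherRow B dst q suc dst y y≢q) (adjust-otherCol A src q (_∸ 1) dst y dst≢src)
    ; src-other = λ y y≢q → trans (adjust-otherCol B dst q suc src y src≢dst) (adjust-otherRow A src q (_∸ 1) src y y≢q)
    ; elsewhere = λ x y x≢s x≢d → trans (adjust-otherCol B dst q suc x y x≢d) (adjust-otherCol A src q (_∸ 1) x y x≢s) }
    where
      B = dec A src q

dec-inc-rowMove : ∀ A x r₁ r₂ → r₁ ≢ r₂ → 0 < A x r₁ → RowMove A (inc (dec A x r₁) x r₂) x r₁ r₂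
dec-inc-rowMove A x r₁ r₂ r₁≢r₂ pos = record
  { dst-suc  = trans (adjust-here B x r₂ suc) (cong suc (adjust-otherRow A x r₁ (_∸ 1) x r₂ (λ e → r₁≢r₂ (sym e))))
  ; src-suc  = trans (pred-suc pos) (cong suc (sym (trans (adjust-otherRow B x r₂ suc x r₁ r₁≢r₂) (adjust-here A x r₁ (_∸ 1)))))
  ; otherRow = λ y y≢r₁ y≢r₂ → trans (adjust-otherRow B x r₂ suc x y y≢r₂) (adjust-otherRow A x r₁ (_∸ 1) x y y≢r₁)
  ; otherCol = λ x′ y x′≢x → trans (adjust-otherCol B x r₂ suc x′ y x′≢x) (adjust-otherCol A x r₁ (_∸ 1) x′ y x′≢x) }
  where
    B = dec A x r₁

-- C′ − A′ = C − A entrywise, stated without subtraction.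
record SameChange (A C A′ C′ : Arr) : Set where
  constructor sameChange
  field same : ∀ p q → C′ p q + A p q ≡ C p q + A′ p q

module _ {A C A′ C′ : Arr} (δ : SameChange A C A′ C′) (p q : ℕ) where
  open SameChange δ

  SameChange-agree : A′ p q ≡ A p q → C′ p q ≡ C p q
  SameChange-agree e = +-cancelʳ-≡ (A p q) _ _ (trans (same p q) (cong (C p q +_) e))

SameChange-refl : ∀ A A′ → SameChange A A A′ A′
SameChange-refl A A′ = sameChange λ p q → +-comm (A′ p q) (A p q)

SameChange-trans : ∀ {A B C A′ B′ C′} → SameChange A B A′ B′ → SameChange B C B′ C′ → SameChange A C A′ C′
SameChange-trans {A} {B} {C} {A′} {B′} {C′} (sameChange δ₁) (sameChange δ₂) = sameChange λ p q → +-cancelʳ-≡ (B p q) _ _ (begin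
  C′ p q + A p q + B p q      ≡⟨ +-assoc (C′ p q) _ _ ⟩
  C′ p q + (A p q + B p q)    ≡⟨ cong (C′ p q +_) (+-comm (A p q) (B p q)) ⟩
  C′ p q + (B p q + A p q)    ≡⟨ +-assoc (C′ p q) _ _ ⟨
  C′ p q + B p q + A p q      ≡⟨ cong (_+ A p q) (δ₂ p q) ⟩
  C p q + B′ p q + A p q      ≡⟨ +-assoc (C p q) _ _ ⟩
  C p q + (B′ p q + A p q)    ≡⟨ cong (C p q +_) (δ₁ p q) ⟩
  C p q + (B p q + A′ p q)    ≡⟨ cong (C p q +_) (+-comm (B p q) (A′ p q)) ⟩
  C p q + (A′ p q + B p q)    ≡⟨ +-assoc (C p q) _ _ ⟨
  C p q + A′ p q + B p q      ∎)
  where open ≡-Reasoning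

columnMove-sameChange : ∀ {A C A′ C′ src dst q} → ColumnMove A C src dst q → ColumnMove A′ C′ src dst q → SameChange A C A′ C′
columnMove-sameChange {A} {C} {A′} {C′} {src} {dst} {q} mv mv′ = sameChange same
  where
    same : ∀ x y → C′ x y + A x y ≡ C x y + A′ x y
    same x y with x ≟ src | x ≟ dst | y ≟ q
    ... | yes refl | _ | yes refl = begin
      C′ x y + A x y              ≡⟨ cong (C′ x y +_) (M.src-suc) ⟩
      C′ x y + suc (C x y)        ≡⟨ +-suc (C′ x y) (C x y) ⟩
      suc (C′ x y + C x y)        ≡⟨ cong suc (+-comm (C′ x y) (C x y)) ⟩
      suc (C x y + C′ x y)        ≡⟨ +-suc (C x y) (C′ x y) ⟨
      C x y + suc (C′ x y)        ≡⟨ cong (C x y +_) M′.src-suc ⟨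
      C x y + A′ x y              ∎
      where
        open ≡-Reasoning
        module M = ColumnMove mv
        module M′ = ColumnMove mv′
    ... | yes refl | _ | no y≢q =
      trans (cong₂ _+_ (ColumnMove.src-other mv′ y y≢q) (sym (ColumnMove.src-other mv y y≢q))) (+-comm (A′ x y) (C x y))
    ... | no _ | yes refl | yes refl = begin
      C′ x y + A x y              ≡⟨ cong (_+ A x y) M′.dst-suc ⟩
      suc (A′ x y + A x y)        ≡⟨ cong suc (+-comm (A′ x y) (A x y)) ⟩
      suc (A x y) + A′ x y        ≡⟨ cong (_+ A′ x y) M.dst-suc ⟨
      C x y + A′ x y              ∎
      where
        open ≡-Reasoning
        module M = ColumnMove mv
        module M′ = ColumnMove mv′
    ... | no _ | yes refl | no y≢q =
      trans (cong₂ _+_ (ColumnMove.dst-other mv′ y y≢q) (sym (ColumnMove.dst-other mv y y≢q))) (+-comm (A′ x y) (C x y))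
    ... | no x≢s | no x≢d | _ =
      trans (cong₂ _+_ (ColumnMove.elsewhere mv′ x y x≢s x≢d) (sym (ColumnMove.elsewhere mv x y x≢s x≢d))) (+-comm (A′ x y) (C x y))

columnMove-undo : ∀ {A C D src dst q} → ColumnMove A C src dst q → ColumnMove C D dst src q → D ≋ A
columnMove-undo {src = src} {dst} {q} mv mv′ x y with x ≟ src | x ≟ dst | y ≟ q
... | yes refl | _ | yes refl = trans (ColumnMove.dst-suc mv′) (sym (ColumnMove.src-suc mv))
... | yes refl | _ | no y≢q = trans (ColumnMove.dst-other mv′ y y≢q) (ColumnMove.src-other mv y y≢q)
... | no _ | yes refl | yes refl = suc-injective (trans (sym (ColumnMove.src-suc mv′)) (ColumnMove.dst-suc mv))
... | no _ | yes refl | no y≢q = trans (ColumnMove.src-other mv′ y y≢q) (ColumnMove.dst-other mv y y≢q)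
... | no x≢s | no x≢d | _ = trans (ColumnMove.elsewhere mv′ x y x≢d x≢s) (ColumnMove.elsewhere mv x y x≢s x≢d)

-- The crystal operators case by case

⊖-+ : ∀ c y → (c + y) ⊖ y ≡ ℤ.+ c
⊖-+ c y = trans (ℤᵖ.m-n≡m⊖n (c + y) y) (trans (ℤᵖ.⊖-≥ (m≤n+m y c)) (cong ℤ.+_ (m+n∸n≡m c y)))

[m+o]∸[n+o]≡m∸n : ∀ m n o → (m + o) ∸ (n + o) ≡ m ∸ n
[m+o]∸[n+o]≡m∸n m n o = trans (cong₂ _∸_ (+-comm m o) (+-comm n o)) ([m+n]∸[m+o]≡n∸o o m n)

⊖-cancelʳ : ∀ {x y z} → y ≤ x → x ⊖ y ≡ ℤ.+ ((x + z) ∸ (y + z))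
⊖-cancelʳ {x} {y} {z} y≤x = begin
  x ⊖ y                        ≡⟨ cong (_⊖ y) (m∸n+n≡m y≤x) ⟨
  ((x ∸ y) + y) ⊖ y            ≡⟨ ⊖-+ (x ∸ y) y ⟩
  ℤ.+ (x ∸ y)                  ≡⟨ cong ℤ.+_ ([m+o]∸[n+o]≡m∸n x y z) ⟨
  ℤ.+ ((x + z) ∸ (y + z))      ∎
  where open ≡-Reasoning

module Operators (n i m : ℕ) where
  open Crystal n i m

  private
    positive-if : ∀ {X : Set} {z} (x y : X) → 0 < z → (if positive (ℤ.+ z) then x else y) ≡ x
    positive-if {z = suc _} _ _ _ = refl

    positive-just⁻¹ : ∀ {z} {x y : Arr} → (if positive (ℤ.+ z) then just x else nothing) ≡ just y → 0 < z × x ≡ y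
    positive-just⁻¹ {suc _} refl = s≤s z≤n , refl

  f-defined : ∀ ℓ A {z} → φ ℓ A ≡ ℤ.+ z → 0 < z → f ℓ A ≡ just (fMove ℓ A)
  f-defined ℓ A φ≡ pos = trans (cong (λ z → if positive z then just (fMove ℓ A) else nothing) φ≡) (positive-if _ _ pos)

  e-defined : ∀ ℓ A {z} → ε ℓ A ≡ ℤ.+ z → 0 < z → e ℓ A ≡ just (eMove ℓ A)
  e-defined ℓ A ε≡ pos = trans (cong (λ z → if positive z then just (eMove ℓ A) else nothing) ε≡) (positive-if _ _ pos)

  f-defined⁻¹ : ∀ ℓ A {z C} → φ ℓ A ≡ ℤ.+ z → f ℓ A ≡ just C → 0 < z × fMove ℓ A ≡ C
  f-defined⁻¹ ℓ A φ≡ fA = positive-just⁻¹ (trans (cong (λ z → if positive z then just (fMove ℓ A) else nothing) (sym φ≡)) fA)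

  e-defined⁻¹ : ∀ ℓ A {z C} → ε ℓ A ≡ ℤ.+ z → e ℓ A ≡ just C → 0 < z × eMove ℓ A ≡ C
  e-defined⁻¹ ℓ A ε≡ eA = positive-just⁻¹ (trans (cong (λ z → if positive z then just (eMove ℓ A) else nothing) (sym ε≡)) eA)

  fφ-value : ∀ j A {c} → φ j A ≡ ℤ.+ c → fφ j A ≡ iter (f j) c A
  fφ-value j A φ≡ = cong (λ z → iterℤ (f j) z A) φ≡

  eε-value : ∀ j c A {d} → ε j A ≡ ℤ.+ (d + c) → eε- j c A ≡ iter (e j) d A
  eε-value j c A {d} ε≡ = cong (λ z → iterℤ (e j) z A) (trans (cong (ℤ._- ℤ.+ c) ε≡) (⊖-+ d c))

  private
    <-≢-suc+ : ∀ a k → a ≢ suc (a + k)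
    <-≢-suc+ a k e = <-irrefl e (s≤s (m≤m+n a k))

    ≮-suc+ : ∀ a k → ¬ (suc (a + k) < a)
    ≮-suc+ a k lt = <-asym lt (<-≤-trans (s≤s (m≤m+n a k)) ≤-refl)

  module _ {ℓ : ℕ} (ℓ<i : ℓ < i) (A : Arr) where

    φ-below : φ ℓ A ≡ Σ[ p₋ A ℓ ⋯ n ] (λ j → A (suc ℓ) j) ⊖ Σ[ suc (p₋ A ℓ) ⋯ n ] (λ j → A ℓ j)
    φ-below with compare ℓ i
    ... | less _ _      = refl
    ... | equal _       = ⊥-elim (<-irrefl refl ℓ<i)
    ... | greater _ k   = ⊥-elim (≮-suc+ i k ℓ<i)

    ε-below : ε ℓ A ≡ Σ[ i ⋯ q₋ A ℓ ] (λ j → A ℓ j) ⊖ Σ[ i ⋯ q₋ A ℓ ∸ 1 ] (λ j → A (suc ℓ) j)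
    ε-below with compare ℓ i
    ... | less _ _      = refl
    ... | equal _       = ⊥-elim (<-irrefl refl ℓ<i)
    ... | greater _ k   = ⊥-elim (≮-suc+ i k ℓ<i)

    fMove-below : fMove ℓ A ≡ dec (inc A ℓ (p₋ A ℓ)) (suc ℓ) (p₋ A ℓ)
    fMove-below with compare ℓ i
    ... | less _ _      = refl
    ... | equal _       = ⊥-elim (<-irrefl refl ℓ<i)
    ... | greater _ k   = ⊥-elim (≮-suc+ i k ℓ<i)

    eMove-below : eMove ℓ A ≡ inc (dec A ℓ (q₋ A ℓ)) (suc ℓ) (q₋ A ℓ)
    eMove-below with compare ℓ i
    ... | less _ _      = refl
    ... | equal _       = ⊥-elim (<-irrefl refl ℓ<i)
    ... | greater _ k   = ⊥-elim (≮-suc+ i k ℓ<i)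

  module _ {ℓ : ℕ} (ℓ≡i : ℓ ≡ i) (A : Arr) where

    φ-at : φ ℓ A ≡ m ⊖ (Σ[ 1 ⋯ i ∸ 1 ] (λ j → A j i) + Σ[ i ⋯ n ] (λ j → A i j))
    φ-at with compare ℓ i
    ... | equal _       = refl
    ... | less _ k      = ⊥-elim (<-≢-suc+ ℓ k ℓ≡i)
    ... | greater _ k   = ⊥-elim (<-≢-suc+ i k (sym ℓ≡i))

    ε-at : ε ℓ A ≡ ℤ.+ A i i
    ε-at with compare ℓ i
    ... | equal _       = refl
    ... | less _ k      = ⊥-elim (<-≢-suc+ ℓ k ℓ≡i)
    ... | greater _ k   = ⊥-elim (<-≢-suc+ i k (sym ℓ≡i))

    fMove-at : fMove ℓ A ≡ inc A i i
    fMove-at with compare ℓ i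
    ... | equal _       = refl
    ... | less _ k      = ⊥-elim (<-≢-suc+ ℓ k ℓ≡i)
    ... | greater _ k   = ⊥-elim (<-≢-suc+ i k (sym ℓ≡i))

    eMove-at : eMove ℓ A ≡ dec A i i
    eMove-at with compare ℓ i
    ... | equal _       = refl
    ... | less _ k      = ⊥-elim (<-≢-suc+ ℓ k ℓ≡i)
    ... | greater _ k   = ⊥-elim (<-≢-suc+ i k (sym ℓ≡i))

  module _ {ℓ : ℕ} (i<ℓ : i < ℓ) (A : Arr) where

    φ-above : φ ℓ A ≡ Σ[ 1 ⋯ p₊ A ℓ ] (λ j → A j (ℓ ∸ 1)) ⊖ Σ[ 1 ⋯ p₊ A ℓ ∸ 1 ] (λ j → A j ℓ)
    φ-above with compare ℓ i
    ... | greater _ _   = refl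
    ... | equal _       = ⊥-elim (<-irrefl refl i<ℓ)
    ... | less _ k      = ⊥-elim (≮-suc+ ℓ k i<ℓ)

    fMove-above : fMove ℓ A ≡ inc (dec A (p₊ A ℓ) (ℓ ∸ 1)) (p₊ A ℓ) ℓ
    fMove-above with compare ℓ i
    ... | greater _ _   = refl
    ... | equal _       = ⊥-elim (<-irrefl refl i<ℓ)
    ... | less _ k      = ⊥-elim (≮-suc+ ℓ k i<ℓ)

-- Iterating partial maps

>>=-cong : ∀ (M : Maybe Arr) {h h′ : Arr → Maybe Arr} → (∀ A → h A ≡ h′ A) → (M >>= h) ≡ (M >>= h′)
>>=-cong nothing  _ = refl
>>=-cong (just A) e = e A

>>=-just⁻¹ : ∀ {M : Maybe Arr} {h : Arr → Maybe Arr} {C} → (M >>= h) ≡ just C → ∃ λ B → M ≡ just B × h B ≡ just C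
>>=-just⁻¹ {just B} e = B , refl , e

module Iteration (n i m : ℕ) where
  open Crystal n i m using (iter)

  module _ (g : Arr → Maybe Arr) where

    iter-+ : ∀ a b A → iter g (a + b) A ≡ (iter g a A >>= iter g b)
    iter-+ zero    b A = refl
    iter-+ (suc a) b A with g A
    ... | nothing = refl
    ... | just B  = iter-+ a b B

    iter-suc-last : ∀ c A → iter g (suc c) A ≡ (iter g c A >>= g)
    iter-suc-last c A = begin
      iter g (suc c) A             ≡⟨ cong (λ c′ → iter g c′ A) (+-comm 1 c) ⟩
      iter g (c + 1) A             ≡⟨ iter-+ c 1 A ⟩
      (iter g c A >>= iter g 1)    ≡⟨ >>=-cong (iter g c A) iter-one ⟩
      (iter g c A >>= g)           ∎
      where
        open ≡-Reasoning
        iter-one : ∀ B → iter g 1 B ≡ g B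
        iter-one B with g B
        ... | nothing = refl
        ... | just _  = refl

    iter-preserves : (_~_ : Arr → Arr → Set) → (∀ {A} → A ~ A) → (∀ {A B C} → A ~ B → B ~ C → A ~ C) →
                     (∀ {A C} → g A ≡ just C → A ~ C) → ∀ c {A C} → iter g c A ≡ just C → A ~ C
    iter-preserves _~_ refl~ trans~ step zero    refl = refl~
    iter-preserves _~_ refl~ trans~ step (suc c) gᶜA with >>=-just⁻¹ gᶜA
    ... | B , gA , gᶜB = trans~ (step gA) (iter-preserves _~_ refl~ trans~ step c gᶜB)

    iter-counts : (κ : Arr → ℕ) → (∀ {A C} → g A ≡ just C → κ C ≡ suc (κ A)) →
                  ∀ c {A C} → iter g c A ≡ just C → κ C ≡ c + κ A
    iter-counts κ step zero    refl = refl
    iter-counts κ step (suc c) gᶜA with >>=-just⁻¹ gᶜA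
    ... | B , gA , gᶜB = trans (iter-counts κ step c gᶜB) (trans (cong (c +_) (step gA)) (+-suc c _))

    iter-defined : (κ : Arr → ℕ) → (∀ A → 0 < κ A → ∃ λ C → g A ≡ just C × κ A ≡ suc (κ C)) →
                   ∀ c A → c ≤ κ A → ∃ λ C → iter g c A ≡ just C × κ A ≡ c + κ C
    iter-defined κ step zero    A _   = A , refl , refl
    iter-defined κ step (suc c) A c<κ with step A (<-≤-trans z<s c<κ)
    ... | B , gA , κA≡ with iter-defined κ step c B (≤-pred (subst (suc c ≤_) κA≡ c<κ))
    ... | C , gᶜB , κB≡ = C , trans (cong (_>>= iter g c) gA) gᶜB , trans κA≡ (cong suc κB≡)

    iter-simulate : (Rel : Arr → Arr → Set) →
      (∀ {A A′ C} → Rel A A′ → g A ≡ just C → ∃ λ C′ → g A′ ≡ just C′ × SameChange A C A′ C′ × Rel C C′) →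
      ∀ c {A A′ C} → Rel A A′ → iter g c A ≡ just C → ∃ λ C′ → iter g c A′ ≡ just C′ × SameChange A C A′ C′ × Rel C C′
    iter-simulate Rel step zero {A} {A′} rel refl = A′ , refl , SameChange-refl A A′ , rel
    iter-simulate Rel step (suc c) rel gᶜA with >>=-just⁻¹ gᶜA
    ... | B , gA , gᶜB with step rel gA
    ... | B′ , gA′ , δ₁ , rel′ with iter-simulate Rel step c rel′ gᶜB
    ... | C′ , gᶜB′ , δ₂ , rel″ = C′ , trans (cong (_>>= iter g c) gA′) gᶜB′ , SameChange-trans δ₁ δ₂ , rel″

  iter-undo : (g h : Arr → Maybe Arr) →
    (∀ {A C} → g A ≡ just C → ∃ λ D → h C ≡ just D × D ≋ A) →
    (∀ {A A′ C} → A′ ≋ A → h A ≡ just C → ∃ λ C′ → h A′ ≡ just C′ × C′ ≋ C) →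
    ∀ c {A C} → iter g c A ≡ just C → ∃ λ D → iter h c C ≡ just D × D ≋ A
  iter-undo g h undo h-cong zero {A} refl = A , refl , λ _ _ → refl
  iter-undo g h undo h-cong (suc c) {A} {C} gᶜA with >>=-just⁻¹ gᶜA
  ... | B , gA , gᶜB with iter-undo g h undo h-cong c gᶜB | undo gA
  ... | D₁ , hᶜC , D₁≋B | D₂ , hB , D₂≋A with h-cong D₁≋B hB
  ... | D , hD₁ , D≋D₂ =
    D , trans (iter-suc-last h c C) (trans (cong (_>>= h) hᶜC) hD₁) , λ p q → trans (D≋D₂ p q) (D₂≋A p q)

runSeq : (ℕ → Arr → Maybe Arr) → List ℕ → Arr → Maybe Arr
runSeq g []       A = just A
runSeq g (x ∷ xs) A = g x A >>= runSeq g xs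

>>=-assoc : ∀ (M : Maybe Arr) (h₁ h₂ : Arr → Maybe Arr) → ((M >>= h₁) >>= h₂) ≡ (M >>= λ A → h₁ A >>= h₂)
>>=-assoc nothing  _ _ = refl
>>=-assoc (just A) _ _ = refl

>>=-just : ∀ (M : Maybe Arr) → (M >>= just) ≡ M
>>=-just nothing  = refl
>>=-just (just A) = refl

runSeq-++ : ∀ g xs ys A → runSeq g (xs ++ ys) A ≡ (runSeq g xs A >>= runSeq g ys)
runSeq-++ g []       ys A = refl
runSeq-++ g (x ∷ xs) ys A = trans (>>=-cong (g x A) (λ B → runSeq-++ g xs ys B)) (sym (>>=-assoc (g x A) (runSeq g xs) (runSeq g ys)))

private
  runSeq-unique : ∀ g (F : List ℕ → Arr → Maybe Arr) →
    (∀ A → F [] A ≡ just A) → (∀ x xs A → F (x ∷ xs) A ≡ (g x A >>= F xs)) →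
    ∀ xs A → F xs A ≡ runSeq g xs A
  runSeq-unique g F nil cons []       A = nil A
  runSeq-unique g F nil cons (x ∷ xs) A = trans (cons x xs A) (>>=-cong (g x A) (runSeq-unique g F nil cons xs))

-- upSeq and downSeq fold over their list with a local helper; runSeq-unique identifies it with runSeq
-- (the helper itself is solved for by unification once the list has been abstracted).
upSeq-runSeq : ∀ a b g A → upSeq a b g A ≡ runSeq g (range a b) A
upSeq-runSeq a b g A with range a b | runSeq-unique g _ (λ _ → refl) (λ _ _ _ → refl)
... | []     | _ = refl
... | x ∷ xs | tail≡ with g x A
...   | nothing = refl
...   | just C  = tail≡ xs C

downSeq-runSeq : ∀ a b g A → downSeq a b g A ≡ runSeq g (reverse (range a b)) A
downSeq-runSeq a b g A with reverse (range a b) | runSeq-unique g _ (λ _ → refl) (λ _ _ _ → refl)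
... | []     | _ = refl
... | x ∷ xs | tail≡ with g x A
...   | nothing = refl
...   | just C  = tail≡ xs C

-- The operators f_ℓ and e_ℓ for ℓ < i

module _ {A C : Arr} {src dst q : ℕ} (mv : ColumnMove A C src dst q) where
  open ColumnMove mv

  Σ-dst-∋ : ∀ a b → a ≤ q → q ≤ b → Σ[ a ⋯ b ] (λ j → C dst j) ≡ suc (Σ[ a ⋯ b ] (λ j → A dst j))
  Σ-dst-∋ a b a≤q q≤b = Σ-suc a b (λ j → A dst j) q a≤q q≤b dst-suc dst-other

  Σ-src-∋ : ∀ a b → a ≤ q → q ≤ b → Σ[ a ⋯ b ] (λ j → A src j) ≡ suc (Σ[ a ⋯ b ] (λ j → C src j))
  Σ-src-∋ a b a≤q q≤b = Σ-suc a b (λ j → C src j) q a≤q q≤b src-suc (λ y y≢q → sym (src-other y y≢q))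

  private
    outside⇒≢ : ∀ {a b y} → q < a ⊎ b < q → a ≤ y → y ≤ b → y ≢ q
    outside⇒≢ (inj₁ q<a) a≤y _ refl = <-irrefl refl (<-≤-trans q<a a≤y)
    outside⇒≢ (inj₂ b<q) _ y≤b refl = <-irrefl refl (≤-<-trans y≤b b<q)

  Σ-dst-∌ : ∀ a b → q < a ⊎ b < q → Σ[ a ⋯ b ] (λ j → C dst j) ≡ Σ[ a ⋯ b ] (λ j → A dst j)
  Σ-dst-∌ a b out = Σ-cong a b _ (λ y a≤y y≤b → dst-other y (outside⇒≢ out a≤y y≤b))

  Σ-src-∌ : ∀ a b → q < a ⊎ b < q → Σ[ a ⋯ b ] (λ j → C src j) ≡ Σ[ a ⋯ b ] (λ j → A src j)
  Σ-src-∌ a b out = Σ-cong a b _ (λ y a≤y y≤b → src-other y (outside⇒≢ out a≤y y≤b))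

record Transfer (A C : Arr) (src dst q c : ℕ) : Set where
  field
    dst-+     : C dst q ≡ A dst q + c
    src-+     : A src q ≡ C src q + c
    dst-other : ∀ y → y ≢ q → C dst y ≡ A dst y
    src-other : ∀ y → y ≢ q → C src y ≡ A src y
    elsewhere : ∀ x y → x ≢ src → x ≢ dst → C x y ≡ A x y

Transfer-zero : ∀ A src dst q → Transfer A A src dst q 0
Transfer-zero A src dst q = record
  { dst-+ = sym (+-identityʳ _) ; src-+ = sym (+-identityʳ _)
  ; dst-other = λ _ _ → refl ; src-other = λ _ _ → refl ; elsewhere = λ _ _ _ _ → refl }

columnMove-transfer : ∀ {A B C src dst q c} → ColumnMove A B src dst q → Transfer B C src dst q c → Transfer A C src dst q (suc c)
columnMove-transfer {c = c} mv tr = record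
  { dst-+ = trans T.dst-+ (trans (cong (_+ c) M.dst-suc) (sym (+-suc _ c)))
  ; src-+ = trans M.src-suc (trans (cong suc T.src-+) (sym (+-suc _ c)))
  ; dst-other = λ y y≢q → trans (T.dst-other y y≢q) (M.dst-other y y≢q)
  ; src-other = λ y y≢q → trans (T.src-other y y≢q) (M.src-other y y≢q)
  ; elsewhere = λ x y x≢s x≢d → trans (T.elsewhere x y x≢s x≢d) (M.elsewhere x y x≢s x≢d) }
  where
    module M = ColumnMove mv
    module T = Transfer tr

module ColumnPair (n i m : ℕ) (1≤i : 1 ≤ i) (i≤n : i ≤ n) where
  open Crystal n i m
  open Operators n i m
  open Iteration n i m

  colSum : Arr → ℕ → ℕ
  colSum A x = Σ[ i ⋯ n ] (λ j → A x j)

  -- U A ℓ = W A ℓ i; a start p > i compares column ℓ with Dyck paths entering it at row p.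
  W : Arr → ℕ → ℕ → ℕ → ℕ
  W A ℓ p y = Σ[ p ⋯ y ] (λ j → A ℓ j) + Σ[ y ⋯ n ] (λ j → A (suc ℓ) j)

  maxU : Arr → ℕ → ℕ
  maxU A ℓ = U A ℓ (p₋ A ℓ)

  -- For ℓ < i, φ_ℓ and ε_ℓ are max_p U_p minus the sum of column ℓ, resp. ℓ + 1 (φ-below-value, ε-below-value).
  φℕ εℕ : Arr → ℕ → ℕ
  φℕ A ℓ = maxU A ℓ ∸ colSum A ℓ
  εℕ A ℓ = maxU A ℓ ∸ colSum A (suc ℓ)

  module _ (A : Arr) (ℓ : ℕ) where

    p₋-isLastMax : IsLastMax (U A ℓ) i n (p₋ A ℓ)
    p₋-isLastMax = pLarge-isLastMax (U A ℓ) i n i≤n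

    q₋-isFirstMax : IsFirstMax (U A ℓ) i n (q₋ A ℓ)
    q₋-isFirstMax = pSmall-isFirstMax (U A ℓ) i n i≤n

    U≤maxU : ∀ y → i ≤ y → y ≤ n → U A ℓ y ≤ maxU A ℓ
    U≤maxU = IsLastMax.maximal p₋-isLastMax

    U-q₋ : U A ℓ (q₋ A ℓ) ≡ maxU A ℓ
    U-q₋ = ≤-antisym (U≤maxU _ (IsFirstMax.lower q₋-isFirstMax) (IsFirstMax.upper q₋-isFirstMax))
                     (IsFirstMax.maximal q₋-isFirstMax _ (IsLastMax.lower p₋-isLastMax) (IsLastMax.upper p₋-isLastMax))

    U-first : U A ℓ i ≡ A ℓ i + colSum A (suc ℓ)
    U-first = cong (_+ colSum A (suc ℓ)) (Σ-single i (λ j → A ℓ j))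

    U-last : U A ℓ n ≡ colSum A ℓ + A (suc ℓ) n
    U-last = cong (colSum A ℓ +_) (Σ-single n (λ j → A (suc ℓ) j))

    U-step : ∀ p → i ≤ p → p < n → U A ℓ (suc p) + A (suc ℓ) p ≡ U A ℓ p + A ℓ (suc p)
    U-step p i≤p p<n = begin
      U A ℓ (suc p) + A (suc ℓ) p            ≡⟨ cong (λ x → x + b + A (suc ℓ) p) (Σ-last i p (λ j → A ℓ j) (m≤n⇒m≤1+n i≤p)) ⟩
      (a + A ℓ (suc p)) + b + A (suc ℓ) p    ≡⟨ swap a b (A ℓ (suc p)) (A (suc ℓ) p) ⟩
      a + (A (suc ℓ) p + b) + A ℓ (suc p)    ≡⟨ cong (λ x → a + x + A ℓ (suc p)) (Σ-first p n (λ j → A (suc ℓ) j) (<⇒≤ p<n)) ⟨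
      U A ℓ p + A ℓ (suc p)                  ∎
      where
        open ≡-Reasoning
        a = Σ[ i ⋯ p ] (λ j → A ℓ j)
        b = Σ[ suc p ⋯ n ] (λ j → A (suc ℓ) j)
        swap : ∀ a b x y → (a + x) + b + y ≡ a + (y + b) + x
        swap = solve-∀

    maxU-at-i : (∀ y → i < y → y ≤ n → U A ℓ y ≤ U A ℓ i) → maxU A ℓ ≡ U A ℓ i
    maxU-at-i U≤ = ≤-antisym (U≤′ _ (IsLastMax.lower p₋-isLastMax) (IsLastMax.upper p₋-isLastMax)) (U≤maxU i ≤-refl i≤n)
      where
        U≤′ : ∀ y → i ≤ y → y ≤ n → U A ℓ y ≤ U A ℓ i
        U≤′ y i≤y y≤n with m≤n⇒m<n∨m≡n i≤y
        ... | inj₁ i<y  = U≤ y i<y y≤n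
        ... | inj₂ refl = ≤-refl

    colSum≤maxU : colSum A ℓ ≤ maxU A ℓ
    colSum≤maxU = ≤-trans (m≤m+n _ _) (U≤maxU n i≤n ≤-refl)

    colSum-suc≤maxU : colSum A (suc ℓ) ≤ maxU A ℓ
    colSum-suc≤maxU = ≤-trans (m≤n+m _ _) (U≤maxU i ≤-refl i≤n)

    φ-below-value : ℓ < i → φ ℓ A ≡ ℤ.+ φℕ A ℓ
    φ-below-value ℓ<i = trans (φ-below ℓ<i A) (trans (⊖-cancelʳ w≥u) (cong ℤ.+_ (cong₂ _∸_ (+-comm _ a) split)))
      where
        p = p₋ A ℓ
        a = Σ[ i ⋯ p ] (λ j → A ℓ j)
        split : Σ[ suc p ⋯ n ] (λ j → A ℓ j) + a ≡ colSum A ℓ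
        split = trans (+-comm _ a) (sym (Σ-split i p n (λ j → A ℓ j) (m≤n⇒m≤1+n (IsLastMax.lower p₋-isLastMax)) (IsLastMax.upper p₋-isLastMax)))
        w≥u : Σ[ suc p ⋯ n ] (λ j → A ℓ j) ≤ Σ[ p ⋯ n ] (λ j → A (suc ℓ) j)
        w≥u = +-cancelˡ-≤ a _ _ (subst (_≤ maxU A ℓ) (trans (sym split) (+-comm _ a)) colSum≤maxU)

    ε-below-value : ℓ < i → ε ℓ A ≡ ℤ.+ εℕ A ℓ
    ε-below-value ℓ<i = trans (ε-below ℓ<i A) (trans (⊖-cancelʳ u≥w) (cong ℤ.+_ (cong₂ _∸_ U-q₋ split)))
      where
        q = q₋ A ℓ
        1≤q = ≤-trans 1≤i (IsFirstMax.lower q₋-isFirstMax)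
        q-1+1 : suc (q ∸ 1) ≡ q
        q-1+1 = trans (+-comm 1 (q ∸ 1)) (m∸n+n≡m 1≤q)
        b = Σ[ q ⋯ n ] (λ j → A (suc ℓ) j)
        split : Σ[ i ⋯ q ∸ 1 ] (λ j → A (suc ℓ) j) + b ≡ colSum A (suc ℓ)
        split = sym (trans (Σ-split i (q ∸ 1) n (λ j → A (suc ℓ) j) (subst (i ≤_) (sym q-1+1) (IsFirstMax.lower q₋-isFirstMax))
                                                                        (≤-trans (m∸n≤m q 1) (IsFirstMax.upper q₋-isFirstMax)))
                           (cong (λ x → Σ[ i ⋯ q ∸ 1 ] (λ j → A (suc ℓ) j) + Σ[ x ⋯ n ] (λ j → A (suc ℓ) j)) q-1+1))
        u≥w : Σ[ i ⋯ q ∸ 1 ] (λ j → A (suc ℓ) j) ≤ Σ[ i ⋯ q ] (λ j → A ℓ j)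
        u≥w = +-cancelʳ-≤ b _ _ (subst₂ _≤_ (sym split) (sym U-q₋) colSum-suc≤maxU)

    private
      lastMax-src-positive : ∀ p → IsLastMax (U A ℓ) i n p → 0 < U A ℓ p ∸ colSum A ℓ → 0 < A (suc ℓ) p
      lastMax-src-positive p max pos with m≤n⇒m<n∨m≡n (IsLastMax.upper max)
      ... | inj₂ refl = subst (0 <_) (trans (cong (_∸ colSum A ℓ) U-last) (m+n∸m≡n (colSum A ℓ) (A (suc ℓ) n))) pos
      ... | inj₁ p<n  = ≤-<-trans z≤n (+-cancelˡ-< (U A ℓ p) _ _
                          (subst (_< U A ℓ p + A (suc ℓ) p) (U-step p (IsLastMax.lower max) p<n)
                                 (+-monoˡ-< (A (suc ℓ) p) (IsLastMax.after max (suc p) ≤-refl p<n))))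

      firstMax-src-positive : ∀ q → IsFirstMax (U A ℓ) i n q → 0 < U A ℓ q ∸ colSum A (suc ℓ) → 0 < A ℓ q
      firstMax-src-positive q max pos with m≤n⇒m<n∨m≡n (IsFirstMax.lower max)
      ... | inj₂ refl = subst (0 <_) (trans (cong (_∸ colSum A (suc ℓ)) U-first) (m+n∸n≡m (A ℓ i) (colSum A (suc ℓ)))) pos
      firstMax-src-positive (suc q) max pos | inj₁ i<q = ≤-<-trans z≤n (+-cancelˡ-< (U A ℓ q) _ _
                          (subst (U A ℓ q + A (suc ℓ) q <_) (U-step q (≤-pred i<q) (IsFirstMax.upper max))
                                 (+-monoˡ-< (A (suc ℓ) q) (IsFirstMax.before max q (≤-pred i<q) ≤-refl))))

    f-src-positive : 0 < φℕ A ℓ → 0 < A (suc ℓ) (p₋ A ℓ)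
    f-src-positive = lastMax-src-positive (p₋ A ℓ) p₋-isLastMax

    e-src-positive : 0 < εℕ A ℓ → 0 < A ℓ (q₋ A ℓ)
    e-src-positive pos = firstMax-src-positive (q₋ A ℓ) q₋-isFirstMax (subst (λ x → 0 < x ∸ colSum A (suc ℓ)) (sym U-q₋) pos)

  module _ {ℓ : ℕ} (ℓ<i : ℓ < i) (A : Arr) where

    f-below-defined : 0 < φℕ A ℓ → f ℓ A ≡ just (fMove ℓ A)
    f-below-defined = f-defined ℓ A (φ-below-value A ℓ ℓ<i)

    e-below-defined : 0 < εℕ A ℓ → e ℓ A ≡ just (eMove ℓ A)
    e-below-defined = e-defined ℓ A (ε-below-value A ℓ ℓ<i)

    f-below-move : 0 < φℕ A ℓ → ColumnMove A (fMove ℓ A) (suc ℓ) ℓ (p₋ A ℓ)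
    f-below-move pos = subst (λ C → ColumnMove A C (suc ℓ) ℓ (p₋ A ℓ)) (sym (fMove-below ℓ<i A))
                         (inc-dec-columnMove A (suc ℓ) ℓ (p₋ A ℓ) (λ e → <-irrefl (sym e) ≤-refl) (f-src-positive A ℓ pos))

    e-below-move : 0 < εℕ A ℓ → ColumnMove A (eMove ℓ A) ℓ (suc ℓ) (q₋ A ℓ)
    e-below-move pos = subst (λ C → ColumnMove A C ℓ (suc ℓ) (q₋ A ℓ)) (sym (eMove-below ℓ<i A))
                         (dec-inc-columnMove A ℓ (suc ℓ) (q₋ A ℓ) (λ e → <-irrefl e ≤-refl) (e-src-positive A ℓ pos))

    f-below-step⁻¹ : ∀ {C} → f ℓ A ≡ just C → 0 < φℕ A ℓ × ColumnMove A C (suc ℓ) ℓ (p₋ A ℓ)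
    f-below-step⁻¹ fA with f-defined⁻¹ ℓ A (φ-below-value A ℓ ℓ<i) fA
    ... | pos , refl = pos , f-below-move pos

    e-below-step⁻¹ : ∀ {C} → e ℓ A ≡ just C → 0 < εℕ A ℓ × ColumnMove A C ℓ (suc ℓ) (q₋ A ℓ)
    e-below-step⁻¹ eA with e-defined⁻¹ ℓ A (ε-below-value A ℓ ℓ<i) eA
    ... | pos , refl = pos , e-below-move pos

  module MoveDown {A C : Arr} {ℓ q : ℕ} (mv : ColumnMove A C (suc ℓ) ℓ q) where

    W-after : ∀ p y → q < p → p ≤ y → W C ℓ p y ≡ W A ℓ p y
    W-after p y q<p p≤y = cong₂ _+_ (Σ-dst-∌ mv p y (inj₁ q<p)) (Σ-src-∌ mv y n (inj₁ (<-≤-trans q<p p≤y)))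

    W-between : ∀ p y → p ≤ q → q < y → W C ℓ p y ≡ suc (W A ℓ p y)
    W-between p y p≤q q<y = cong₂ _+_ (Σ-dst-∋ mv p y p≤q (<⇒≤ q<y)) (Σ-src-∌ mv y n (inj₁ q<y))

    W-at : ∀ p → p ≤ q → q ≤ n → W C ℓ p q ≡ W A ℓ p q
    W-at p p≤q q≤n = begin
      W C ℓ p q                                                   ≡⟨ cong (_+ Σ[ q ⋯ n ] (λ j → C (suc ℓ) j)) (Σ-dst-∋ mv p q p≤q ≤-refl) ⟩
      suc (Σ[ p ⋯ q ] (λ j → A ℓ j)) + Σ[ q ⋯ n ] (λ j → C (suc ℓ) j) ≡⟨ +-suc _ _ ⟨
      Σ[ p ⋯ q ] (λ j → A ℓ j) + suc (Σ[ q ⋯ n ] (λ j → C (suc ℓ) j)) ≡⟨ cong (Σ[ p ⋯ q ] (λ j → A ℓ j) +_) (Σ-src-∋ mv q n ≤-refl q≤n) ⟨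
      W A ℓ p q                                                   ∎
      where open ≡-Reasoning

    W-before : ∀ p y → y < q → q ≤ n → suc (W C ℓ p y) ≡ W A ℓ p y
    W-before p y y<q q≤n = sym (trans (cong₂ _+_ (sym (Σ-dst-∌ mv p y (inj₂ y<q))) (Σ-src-∋ mv y n (<⇒≤ y<q) q≤n)) (+-suc _ _))

  record FStep (A C : Arr) (ℓ : ℕ) : Set where
    field
      move        : ColumnMove A C (suc ℓ) ℓ (p₋ A ℓ)
      φℕ-positive : 0 < φℕ A ℓ
      maxU-same   : maxU C ℓ ≡ maxU A ℓ
      colSum-dst  : colSum C ℓ ≡ suc (colSum A ℓ)
      colSum-src  : colSum A (suc ℓ) ≡ suc (colSum C (suc ℓ))
      q₋-after    : q₋ C ℓ ≡ p₋ A ℓ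

    φℕ-step : φℕ A ℓ ≡ suc (φℕ C ℓ)
    φℕ-step = begin
      maxU A ℓ ∸ colSum A ℓ               ≡⟨ suc-pred _ {{>-nonZero φℕ-positive}} ⟨
      suc (pred (maxU A ℓ ∸ colSum A ℓ))  ≡⟨ cong suc (pred[m∸n]≡m∸[1+n] (maxU A ℓ) (colSum A ℓ)) ⟩
      suc (maxU A ℓ ∸ suc (colSum A ℓ))   ≡⟨ cong suc (cong₂ _∸_ maxU-same colSum-dst) ⟨
      suc (φℕ C ℓ)                        ∎
      where open ≡-Reasoning

    εℕ-step : εℕ C ℓ ≡ suc (εℕ A ℓ)
    εℕ-step = begin
      maxU C ℓ ∸ colSum C (suc ℓ)          ≡⟨ cong (_∸ colSum C (suc ℓ)) maxU-same ⟩
      maxU A ℓ ∸ colSum C (suc ℓ)          ≡⟨ +-∸-assoc 1 (subst (_≤ maxU A ℓ) colSum-src (colSum-suc≤maxU A ℓ)) ⟩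
      suc (maxU A ℓ ∸ suc (colSum C (suc ℓ))) ≡⟨ cong (λ x → suc (maxU A ℓ ∸ x)) colSum-src ⟨
      suc (εℕ A ℓ)                         ∎
      where open ≡-Reasoning

  f-below-step : ∀ {ℓ A C} → ℓ < i → f ℓ A ≡ just C → FStep A C ℓ
  f-below-step {ℓ} {A} {C} ℓ<i fA = record
    { move = mv ; φℕ-positive = pos ; maxU-same = maxU-same
    ; colSum-dst = Σ-dst-∋ mv i n i≤p p≤n ; colSum-src = Σ-src-∋ mv i n i≤p p≤n
    ; q₋-after = pSmall-unique p-isFirstMax }
    where
      pos = proj₁ (f-below-step⁻¹ ℓ<i A fA)
      mv  = proj₂ (f-below-step⁻¹ ℓ<i A fA)
      p = p₋ A ℓ
      open IsLastMax (p₋-isLastMax A ℓ) renaming (lower to i≤p; upper to p≤n)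
      open MoveDown mv
      U-p : U C ℓ p ≡ maxU A ℓ
      U-p = W-at i i≤p p≤n
      U≤ : ∀ y → i ≤ y → y ≤ n → U C ℓ y ≤ maxU A ℓ
      U≤ y i≤y y≤n with <-cmp y p
      ... | tri< y<p _ _ = ≤-trans (n≤1+n _) (subst (_≤ maxU A ℓ) (sym (W-before i y y<p p≤n)) (U≤maxU A ℓ y i≤y y≤n))
      ... | tri≈ _ refl _ = ≤-reflexive U-p
      ... | tri> _ _ p<y = subst (_≤ maxU A ℓ) (sym (W-between i y i≤p p<y)) (after y p<y y≤n)
      maxU-same : maxU C ℓ ≡ maxU A ℓ
      maxU-same = ≤-antisym (U≤ _ (IsLastMax.lower (p₋-isLastMax C ℓ)) (IsLastMax.upper (p₋-isLastMax C ℓ)))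
                            (subst (_≤ maxU C ℓ) U-p (U≤maxU C ℓ p i≤p p≤n))
      p-isFirstMax : IsFirstMax (U C ℓ) i n p
      p-isFirstMax = record
        { lower = i≤p ; upper = p≤n
        ; maximal = λ y i≤y y≤n → subst (U C ℓ y ≤_) (sym U-p) (U≤ y i≤y y≤n)
        ; before = λ y i≤y y<p → subst (U C ℓ y <_) (sym U-p)
                                   (≤-trans (≤-reflexive (W-before i y y<p p≤n)) (U≤maxU A ℓ y i≤y (≤-trans (<⇒≤ y<p) p≤n))) }

  f-below-iterate : ∀ {ℓ} → ℓ < i → ∀ c A → c ≤ φℕ A ℓ →
    ∃ λ C → iter (f ℓ) c A ≡ just C × εℕ C ℓ ≡ c + εℕ A ℓ × colSum C ℓ ≡ c + colSum A ℓ
  f-below-iterate {ℓ} ℓ<i c A c≤φ =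
    C , fᶜA , iter-counts (f ℓ) (λ A → εℕ A ℓ) (λ fA → FStep.εℕ-step (f-below-step ℓ<i fA)) c fᶜA
            , iter-counts (f ℓ) (λ A → colSum A ℓ) (λ fA → FStep.colSum-dst (f-below-step ℓ<i fA)) c fᶜA
    where
      step : ∀ A → 0 < φℕ A ℓ → ∃ λ C → f ℓ A ≡ just C × φℕ A ℓ ≡ suc (φℕ C ℓ)
      step A pos = fMove ℓ A , f-below-defined ℓ<i A pos , FStep.φℕ-step (f-below-step ℓ<i (f-below-defined ℓ<i A pos))
      defined = iter-defined (f ℓ) (λ A → φℕ A ℓ) step c A c≤φ
      C = proj₁ defined
      fᶜA : iter (f ℓ) c A ≡ just C
      fᶜA = proj₁ (proj₂ defined)

  ColumnsFixed : ℕ → Arr → Arr → Set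
  ColumnsFixed ℓ A C = ∀ x y → x ≢ ℓ → x ≢ suc ℓ → C x y ≡ A x y

  private
    ColumnsFixed-refl : ∀ {ℓ A} → ColumnsFixed ℓ A A
    ColumnsFixed-refl _ _ _ _ = refl

    ColumnsFixed-trans : ∀ {ℓ A B C} → ColumnsFixed ℓ A B → ColumnsFixed ℓ B C → ColumnsFixed ℓ A C
    ColumnsFixed-trans ab bc x y x≢ℓ x≢ℓ+1 = trans (bc x y x≢ℓ x≢ℓ+1) (ab x y x≢ℓ x≢ℓ+1)

  f-below-columnsFixed : ∀ {ℓ} → ℓ < i → ∀ c {A C} → iter (f ℓ) c A ≡ just C → ColumnsFixed ℓ A C
  f-below-columnsFixed ℓ<i = iter-preserves _ (ColumnsFixed _) ColumnsFixed-refl ColumnsFixed-trans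
    (λ fA x y x≢ℓ x≢ℓ+1 → ColumnMove.elsewhere (FStep.move (f-below-step ℓ<i fA)) x y x≢ℓ+1 x≢ℓ)

  e-below-columnsFixed : ∀ {ℓ} → ℓ < i → ∀ c {A C} → iter (e ℓ) c A ≡ just C → ColumnsFixed ℓ A C
  e-below-columnsFixed ℓ<i = iter-preserves _ (ColumnsFixed _) ColumnsFixed-refl ColumnsFixed-trans
    (λ {A} eA x y x≢ℓ x≢ℓ+1 → ColumnMove.elsewhere (proj₂ (e-below-step⁻¹ ℓ<i A eA)) x y x≢ℓ x≢ℓ+1)

  -- f_ℓ and e_ℓ only see the column sums and the differences U_p − U_q, which extra units at (ℓ, i) do not change.
  record TopShifted (ℓ d : ℕ) (A A′ : Arr) : Set where
    field
      top   : A′ ℓ i ≡ A ℓ i + d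
      below : ∀ y → y ≢ i → A′ ℓ y ≡ A ℓ y
      next  : ∀ y → A′ (suc ℓ) y ≡ A (suc ℓ) y

  module TopShiftedProperties {ℓ d : ℕ} {A A′ : Arr} (sh : TopShifted ℓ d A A′) where
    open TopShifted sh

    Σ-column-shift : ∀ y → i ≤ y → Σ[ i ⋯ y ] (λ j → A′ ℓ j) ≡ Σ[ i ⋯ y ] (λ j → A ℓ j) + d
    Σ-column-shift y i≤y = begin
      Σ[ i ⋯ y ] (λ j → A′ ℓ j)                       ≡⟨ Σ-first i y _ i≤y ⟩
      A′ ℓ i + Σ[ suc i ⋯ y ] (λ j → A′ ℓ j)          ≡⟨ cong₂ _+_ top (Σ-cong (suc i) y _ (λ z i<z _ → below z (>⇒≢ i<z))) ⟩
      A ℓ i + d + Σ[ suc i ⋯ y ] (λ j → A ℓ j)        ≡⟨ xy∙z≈xz∙y (A ℓ i) d _ ⟩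
      A ℓ i + Σ[ suc i ⋯ y ] (λ j → A ℓ j) + d        ≡⟨ cong (_+ d) (Σ-first i y _ i≤y) ⟨
      Σ[ i ⋯ y ] (λ j → A ℓ j) + d                    ∎
      where open ≡-Reasoning

    Σ-next-same : ∀ y → Σ[ y ⋯ n ] (λ j → A′ (suc ℓ) j) ≡ Σ[ y ⋯ n ] (λ j → A (suc ℓ) j)
    Σ-next-same y = Σ-cong y n _ (λ z _ _ → next z)

    U-shift : ∀ y → i ≤ y → y ≤ n → U A′ ℓ y ≡ U A ℓ y + d
    U-shift y i≤y y≤n = trans (cong₂ _+_ (Σ-column-shift y i≤y) (Σ-next-same y)) (xy∙z≈xz∙y (Σ[ i ⋯ y ] (λ j → A ℓ j)) d (Σ[ y ⋯ n ] (λ j → A (suc ℓ) j)))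

    p₋-same : p₋ A′ ℓ ≡ p₋ A ℓ
    p₋-same = pLarge-shift d U-shift i≤n

    q₋-same : q₋ A′ ℓ ≡ q₋ A ℓ
    q₋-same = pSmall-shift d U-shift i≤n

    maxU-shift : maxU A′ ℓ ≡ maxU A ℓ + d
    maxU-shift = trans (cong (U A′ ℓ) p₋-same) (U-shift _ (IsLastMax.lower (p₋-isLastMax A ℓ)) (IsLastMax.upper (p₋-isLastMax A ℓ)))

    φℕ-same : φℕ A′ ℓ ≡ φℕ A ℓ
    φℕ-same = trans (cong₂ _∸_ maxU-shift (Σ-column-shift n i≤n)) ([m+o]∸[n+o]≡m∸n (maxU A ℓ) (colSum A ℓ) d)

    εℕ-shift : εℕ A′ ℓ ≡ εℕ A ℓ + d
    εℕ-shift = trans (cong₂ _∸_ maxU-shift (Σ-next-same i)) (+-∸-comm d (colSum-suc≤maxU A ℓ))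

  SameChange-topShifted : ∀ {ℓ d A A′ C C′} → SameChange A C A′ C′ → TopShifted ℓ d A A′ → TopShifted ℓ d C C′
  SameChange-topShifted {ℓ} {d} {A} {A′} {C} {C′} δ sh = record
    { top   = +-cancelʳ-≡ (A ℓ i) _ _ (begin
        C′ ℓ i + A ℓ i        ≡⟨ SameChange.same δ ℓ i ⟩
        C ℓ i + A′ ℓ i        ≡⟨ cong (C ℓ i +_) top ⟩
        C ℓ i + (A ℓ i + d)   ≡⟨ x∙yz≈xz∙y (C ℓ i) (A ℓ i) d ⟩
        C ℓ i + d + A ℓ i     ∎)
    ; below = λ y y≢i → SameChange-agree δ ℓ y (below y y≢i)
    ; next  = λ y → SameChange-agree δ (suc ℓ) y (next y) }
    where
      open TopShifted sh
      open ≡-Reasoning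

  module _ {ℓ : ℕ} (ℓ<i : ℓ < i) (d : ℕ) where

    f-topShifted : ∀ {A A′ C} → TopShifted ℓ d A A′ → f ℓ A ≡ just C →
                   ∃ λ C′ → f ℓ A′ ≡ just C′ × SameChange A C A′ C′ × TopShifted ℓ d C C′
    f-topShifted {A′ = A′} sh fA = fMove ℓ A′ , f-below-defined ℓ<i A′ pos′ , δ , SameChange-topShifted δ sh
      where
        open TopShiftedProperties sh
        step = f-below-step ℓ<i fA
        pos′ = subst (0 <_) (sym φℕ-same) (FStep.φℕ-positive step)
        δ = columnMove-sameChange (FStep.move step)
              (subst (ColumnMove A′ (fMove ℓ A′) (suc ℓ) ℓ) p₋-same (f-below-move ℓ<i A′ pos′))

    e-topShifted : ∀ {A A′ C} → TopShifted ℓ d A A′ → e ℓ A ≡ just C →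
                   ∃ λ C′ → e ℓ A′ ≡ just C′ × SameChange A C A′ C′ × TopShifted ℓ d C C′
    e-topShifted {A} {A′} sh eA = eMove ℓ A′ , e-below-defined ℓ<i A′ pos′ , δ , SameChange-topShifted δ sh
      where
        open TopShiftedProperties sh
        pos = proj₁ (e-below-step⁻¹ ℓ<i A eA)
        pos′ = subst (0 <_) (sym εℕ-shift) (≤-trans pos (m≤m+n _ d))
        δ = columnMove-sameChange (proj₂ (e-below-step⁻¹ ℓ<i A eA))
              (subst (ColumnMove A′ (eMove ℓ A′) ℓ (suc ℓ)) q₋-same (e-below-move ℓ<i A′ pos′))

    iter-f-topShifted : ∀ c {A A′ C} → TopShifted ℓ d A A′ → iter (f ℓ) c A ≡ just C →
                        ∃ λ C′ → iter (f ℓ) c A′ ≡ just C′ × SameChange A C A′ C′ × TopShifted ℓ d C C′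
    iter-f-topShifted = iter-simulate (f ℓ) (TopShifted ℓ d) f-topShifted

    iter-e-topShifted : ∀ c {A A′ C} → TopShifted ℓ d A A′ → iter (e ℓ) c A ≡ just C →
                        ∃ λ C′ → iter (e ℓ) c A′ ≡ just C′ × SameChange A C A′ C′ × TopShifted ℓ d C C′
    iter-e-topShifted = iter-simulate (e ℓ) (TopShifted ℓ d) e-topShifted

  module _ {ℓ : ℕ} (ℓ<i : ℓ < i) where

    e-after-f : ∀ {A C} → f ℓ A ≡ just C → ∃ λ D → e ℓ C ≡ just D × D ≋ A
    e-after-f {C = C} fA = eMove ℓ C , e-below-defined ℓ<i C pos , columnMove-undo (FStep.move step) mv
      where
        step = f-below-step ℓ<i fA
        pos = subst (0 <_) (sym (FStep.εℕ-step step)) z<s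
        mv = subst (ColumnMove C (eMove ℓ C) ℓ (suc ℓ)) (FStep.q₋-after step) (e-below-move ℓ<i C pos)

    e-cong : ∀ {A A′ C} → A′ ≋ A → e ℓ A ≡ just C → ∃ λ C′ → e ℓ A′ ≡ just C′ × C′ ≋ C
    e-cong {A} {A′} {C} A′≋A eA = C′ , proj₁ (proj₂ shifted) , λ p q → SameChange-agree δ p q (A′≋A p q)
      where
        unshifted : TopShifted ℓ 0 A A′
        unshifted = record { top = trans (A′≋A ℓ i) (sym (+-identityʳ _)) ; below = λ y _ → A′≋A ℓ y ; next = A′≋A (suc ℓ) }
        shifted = e-topShifted ℓ<i 0 unshifted eA
        C′ = proj₁ shifted
        δ : SameChange A C A′ C′
        δ = proj₁ (proj₂ (proj₂ shifted))

    e-undoes-f : ∀ c {A C} → iter (f ℓ) c A ≡ just C → ∃ λ D → iter (e ℓ) c C ≡ just D × D ≋ A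
    e-undoes-f = iter-undo (f ℓ) (e ℓ) e-after-f e-cong

  TopShifted-congˡ : ∀ {ℓ d A A′ C} → A′ ≋ A → TopShifted ℓ d A′ C → TopShifted ℓ d A C
  TopShifted-congˡ {ℓ} {d} A′≋A sh = record
    { top = trans top (cong (_+ d) (A′≋A ℓ i))
    ; below = λ y y≢i → trans (below y y≢i) (A′≋A ℓ y)
    ; next = λ y → trans (next y) (A′≋A (suc ℓ) y) }
    where open TopShifted sh

  module _ {ℓ : ℕ} (ℓ<i : ℓ < i) where

    f-below-shifted : ∀ c {d B B′ X} → iter (f ℓ) c B ≡ just B′ → TopShifted ℓ d B X →
                      ∃ λ X′ → iter (f ℓ) c X ≡ just X′ × TopShifted ℓ d B′ X′ × ColumnsFixed ℓ X X′
    f-below-shifted c {d} {X = X} fᶜB sh = X′ , fᶜX , proj₂ (proj₂ (proj₂ simulated)) , f-below-columnsFixed ℓ<i c fᶜX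
      where
        simulated = iter-f-topShifted ℓ<i d c sh fᶜB
        X′ = proj₁ simulated
        fᶜX : iter (f ℓ) c X ≡ just X′
        fᶜX = proj₁ (proj₂ simulated)

    -- e_ℓ^c undoes f_ℓ^c even after the top entry (ℓ, i) and the other columns have been changed in between.
    e-below-undoes-shifted : ∀ c {d B B′ Y} → iter (f ℓ) c B ≡ just B′ → TopShifted ℓ d B′ Y →
                             ∃ λ Z → iter (e ℓ) c Y ≡ just Z × TopShifted ℓ d B Z × ColumnsFixed ℓ Y Z
    e-below-undoes-shifted c {d} {B} {Y = Y} fᶜB sh = Z , eᶜY , TopShifted-congˡ B″≋B (proj₂ (proj₂ (proj₂ simulated))) , e-below-columnsFixed ℓ<i c eᶜY
      where
        undone = e-undoes-f ℓ<i c fᶜB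
        B″ = proj₁ undone
        B″≋B : B″ ≋ B
        B″≋B = proj₂ (proj₂ undone)
        simulated = iter-e-topShifted ℓ<i d c sh (proj₁ (proj₂ undone))
        Z = proj₁ simulated
        eᶜY : iter (e ℓ) c Y ≡ just Z
        eᶜY = proj₁ (proj₂ simulated)

  f-below-top : ∀ {ℓ} → ℓ < i → ∀ c A → c ≤ A (suc ℓ) i → (∀ y → i < y → y ≤ n → U A ℓ y + c ≤ U A ℓ i) →
                ∃ λ C → iter (f ℓ) c A ≡ just C × Transfer A C (suc ℓ) ℓ i c
  f-below-top ℓ<i zero A _ _ = A , refl , Transfer-zero A _ _ i
  f-below-top {ℓ} ℓ<i (suc c) A c<src lead =
    C , trans (cong (_>>= iter (f ℓ) c) (f-below-defined ℓ<i A pos)) fᶜC₁ , columnMove-transfer mv transfer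
    where
      i-isLastMax : IsLastMax (U A ℓ) i n i
      i-isLastMax = record { lower = ≤-refl ; upper = i≤n ; maximal = maximal ; after = after }
        where
          after : ∀ y → i < y → y ≤ n → U A ℓ y < U A ℓ i
          after y i<y y≤n = <-≤-trans (m<m+n (U A ℓ y) z<s) (lead y i<y y≤n)
          maximal : ∀ y → i ≤ y → y ≤ n → U A ℓ y ≤ U A ℓ i
          maximal y i≤y y≤n with m≤n⇒m<n∨m≡n i≤y
          ... | inj₁ i<y  = <⇒≤ (after y i<y y≤n)
          ... | inj₂ refl = ≤-refl
      p₋≡i = pLarge-unique i-isLastMax
      colSum<U : colSum A ℓ < U A ℓ i
      colSum<U with m≤n⇒m<n∨m≡n i≤n
      ... | inj₁ i<n  = ≤-<-trans (≤-trans (m≤m+n _ _) (≤-reflexive (sym (U-last A ℓ)))) (IsLastMax.after i-isLastMax n i<n ≤-refl)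
      ... | inj₂ refl = subst (colSum A ℓ <_) (sym (U-last A ℓ)) (m<m+n (colSum A ℓ) (<-≤-trans z<s c<src))
      pos : 0 < φℕ A ℓ
      pos = m<n⇒0<n∸m (subst (λ p → colSum A ℓ < U A ℓ p) (sym p₋≡i) colSum<U)
      C₁ = fMove ℓ A
      mv : ColumnMove A C₁ (suc ℓ) ℓ i
      mv = subst (ColumnMove A C₁ (suc ℓ) ℓ) p₋≡i (f-below-move ℓ<i A pos)
      open MoveDown mv
      c≤src₁ : c ≤ C₁ (suc ℓ) i
      c≤src₁ = ≤-pred (subst (suc c ≤_) (ColumnMove.src-suc mv) c<src)
      lead₁ : ∀ y → i < y → y ≤ n → U C₁ ℓ y + c ≤ U C₁ ℓ i
      lead₁ y i<y y≤n = subst₂ _≤_ (trans (+-suc (U A ℓ y) c) (cong (_+ c) (sym (W-between i y ≤-refl i<y))))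
                                   (sym (W-at i ≤-refl i≤n)) (lead y i<y y≤n)
      rest = f-below-top ℓ<i c C₁ c≤src₁ lead₁
      C = proj₁ rest
      fᶜC₁ = proj₁ (proj₂ rest)
      transfer = proj₂ (proj₂ rest)

  -- Dyck paths entering column ℓ at a row p > i see the sums W _ ℓ p _; f_ℓ never raises their maximum.
  WDominated : ℕ → Arr → Arr → Set
  WDominated ℓ A C = ∀ p → i < p → p ≤ n → ∀ y → p ≤ y → y ≤ n → ∃ λ y′ → p ≤ y′ × y′ ≤ n × W C ℓ p y ≤ W A ℓ p y′

  private
    U-W : ∀ A ℓ p z → i ≤ p → suc p ≤ z → U A ℓ z ≡ Σ[ i ⋯ p ] (λ j → A ℓ j) + W A ℓ (suc p) z
    U-W A ℓ p z i≤p p<z = trans (cong (_+ Σ[ z ⋯ n ] (λ j → A (suc ℓ) j)) (Σ-split i p z (λ j → A ℓ j) (m≤n⇒m≤1+n i≤p) (<⇒≤ p<z)))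
                                  (+-assoc (Σ[ i ⋯ p ] (λ j → A ℓ j)) (Σ[ suc p ⋯ z ] (λ j → A ℓ j)) (Σ[ z ⋯ n ] (λ j → A (suc ℓ) j)))

    f-below-wDominated-step : ∀ {ℓ A C} → FStep A C ℓ → WDominated ℓ A C
    f-below-wDominated-step {ℓ} {A} step (suc p) i<p _ y p<y y≤n with suc p ≤? p₋ A ℓ
    ... | no p≰q = y , p<y , y≤n , ≤-reflexive (W-after (suc p) y (≰⇒> p≰q) p<y)
      where open MoveDown (FStep.move step)
    ... | yes p≤q with <-cmp y (p₋ A ℓ)
    ...   | tri< y<q _ _ = y , p<y , y≤n , ≤-trans (n≤1+n _) (≤-reflexive (W-before (suc p) y y<q q≤n))
      where
        open MoveDown (FStep.move step)
        open IsLastMax (p₋-isLastMax A ℓ) renaming (upper to q≤n)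
    ...   | tri≈ _ refl _ = y , p<y , y≤n , ≤-reflexive (W-at (suc p) p≤q y≤n)
      where open MoveDown (FStep.move step)
    ...   | tri> _ _ q<y = q , p≤q , q≤n , subst (_≤ W A ℓ (suc p) q) (sym (W-between (suc p) y p≤q q<y)) W<
      where
        open MoveDown (FStep.move step)
        open IsLastMax (p₋-isLastMax A ℓ) renaming (upper to q≤n)
        q = p₋ A ℓ
        i≤p = ≤-pred i<p
        W< : W A ℓ (suc p) y < W A ℓ (suc p) q
        W< = +-cancelˡ-< (Σ[ i ⋯ p ] (λ j → A ℓ j)) _ _
               (subst₂ _<_ (U-W A ℓ p y i≤p p<y) (U-W A ℓ p q i≤p p≤q) (after y q<y y≤n))

  f-below-wDominated : ∀ {ℓ} → ℓ < i → ∀ c {A C} → iter (f ℓ) c A ≡ just C → WDominated ℓ A C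
  f-below-wDominated {ℓ} ℓ<i = iter-preserves (f ℓ) (λ A C → WDominated ℓ A C) (λ {A} → refl′ {A}) (λ {A} {B} {C} → trans′ {A} {B} {C})
                                 (λ fA → f-below-wDominated-step (f-below-step ℓ<i fA))
    where
      refl′ : ∀ {A} → WDominated ℓ A A
      refl′ p _ _ y p≤y y≤n = y , p≤y , y≤n , ≤-refl
      trans′ : ∀ {A B C} → WDominated ℓ A B → WDominated ℓ B C → WDominated ℓ A C
      trans′ ab bc p i<p p≤n y p≤y y≤n with bc p i<p p≤n y p≤y y≤n
      ... | y₁ , p≤y₁ , y₁≤n , le₁ with ab p i<p p≤n y₁ p≤y₁ y₁≤n
      ... | y₂ , p≤y₂ , y₂≤n , le₂ = y₂ , p≤y₂ , y₂≤n , ≤-trans le₁ le₂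

-- The operators f_i and e_i

module TopEntry (n i m : ℕ) (1≤i : 1 ≤ i) (i≤n : i ≤ n) where
  open Crystal n i m
  open Operators n i m

  hook : Arr → ℕ
  hook A = Σ[ 1 ⋯ i ∸ 1 ] (λ j → A j i) + Σ[ i ⋯ n ] (λ j → A i j)

  SameOffTop : Arr → Arr → Set
  SameOffTop A C = ∀ x y → x ≢ i ⊎ y ≢ i → C x y ≡ A x y

  private
    adjust-offTop : ∀ A g → SameOffTop A (adjust A i i g)
    adjust-offTop A g x y (inj₁ x≢i) = adjust-otherCol A i i g x y x≢i
    adjust-offTop A g x y (inj₂ y≢i) = adjust-otherRow A i i g x y y≢i

    hook-inc : ∀ A → hook (inc A i i) ≡ suc (hook A)
    hook-inc A = trans (cong₂ _+_ row column) (+-suc _ _)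
      where
        row = Σ-cong 1 (i ∸ 1) _ (λ j _ j≤i-1 → adjust-offTop A suc j i (inj₁ (λ j≡i → <-irrefl j≡i (≤-<-trans j≤i-1 (∸-<  1≤i)))))
          where ∸-< : 1 ≤ i → i ∸ 1 < i
                ∸-< (s≤s _) = ≤-refl
        column = Σ-suc i n (λ j → A i j) i ≤-refl i≤n (adjust-here A i i suc) (λ y y≢i → adjust-offTop A suc i y (inj₂ y≢i))

  f-top-iterate : ∀ c A → c + hook A ≤ m → ∃ λ C → iter (f i) c A ≡ just C × C i i ≡ A i i + c × SameOffTop A C
  f-top-iterate zero    A _ = A , refl , sym (+-identityʳ _) , λ _ _ _ → refl
  f-top-iterate (suc c) A c+h≤m with f-top-iterate c (inc A i i) (subst (_≤ m) (sym (trans (cong (c +_) (hook-inc A)) (+-suc c _))) c+h≤m)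
  ... | C , fᶜ , top , off = C , trans (cong (_>>= iter (f i) c) fA) fᶜ ,
        trans top (trans (cong (_+ c) (adjust-here A i i suc)) (sym (+-suc _ c))) ,
        (λ x y ne → trans (off x y ne) (adjust-offTop A suc x y ne))
    where
      φ≡ : φ i A ≡ ℤ.+ (m ∸ hook A)
      φ≡ = trans (φ-at refl A) (trans (cong (_⊖ hook A) (sym (m∸n+n≡m (≤-trans (m≤n+m _ (suc c)) c+h≤m)))) (⊖-+ _ (hook A)))
      fA : f i A ≡ just (inc A i i)
      fA = trans (f-defined i A φ≡ (m<n⇒0<n∸m (<-≤-trans (s≤s (m≤n+m _ c)) c+h≤m))) (cong just (fMove-at refl A))

  e-top-iterate : ∀ c A → c ≤ A i i → ∃ λ C → iter (e i) c A ≡ just C × A i i ≡ C i i + c × SameOffTop A C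
  e-top-iterate zero    A _ = A , refl , sym (+-identityʳ _) , λ _ _ _ → refl
  e-top-iterate (suc c) A c<top with e-top-iterate c (dec A i i) (subst (c ≤_) (sym (adjust-here A i i (_∸ 1))) (∸-monoˡ-≤ 1 c<top))
  ... | C , eᶜ , top , off = C , trans (cong (_>>= iter (e i) c) eA) eᶜ ,
        trans (sym (m∸n+n≡m pos)) (trans (+-comm _ 1) (trans (cong suc (trans (sym (adjust-here A i i (_∸ 1))) top)) (sym (+-suc _ c)))) ,
        (λ x y ne → trans (off x y ne) (adjust-offTop A (_∸ 1) x y ne))
    where
      pos = <-≤-trans z<s c<top
      eA : e i A ≡ just (dec A i i)
      eA = trans (e-defined i A (ε-at refl A) pos) (cong just (eMove-at refl A))

-- The operators f_ℓ for ℓ > i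

module RowPair (n i m : ℕ) (ℓ′ : ℕ) (i≤ℓ′ : i ≤ ℓ′) where
  open Crystal n i m
  open Operators n i m

  private
    ℓ = suc ℓ′
    i<ℓ : i < ℓ
    i<ℓ = s≤s i≤ℓ′

  rowSum : Arr → ℕ → ℕ
  rowSum A y = Σ[ 1 ⋯ i ] (λ x → A x y)

  record Separated (A : Arr) (c : ℕ) : Set where
    field
      c≤i        : c ≤ i
      upperLeft  : ∀ x → c < x → x ≤ i → A x ℓ′ ≡ 0
      lowerRight : ∀ x → 1 ≤ x → x < c → A x ℓ ≡ 0

  record Pivot (A : Arr) (N c′ : ℕ) : Set where
    field
      1≤c′       : 1 ≤ c′
      source>0   : 0 < A c′ ℓ′
      separated  : Separated A c′
      p₊≡        : p₊ A ℓ ≡ c′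
      φ≡         : φ ℓ A ≡ ℤ.+ suc N

  module _ {A : Arr} {c₀ : ℕ} (sep : Separated A (suc c₀)) (source>0 : 0 < A (suc c₀) ℓ′) where
    private
      open Separated sep
      u = λ x → A x ℓ′
      v = λ x → A x ℓ

      u-prefix : ∀ p → suc c₀ ≤ p → p ≤ i → Σ[ 1 ⋯ p ] u ≡ Σ[ 1 ⋯ suc c₀ ] u
      u-prefix p c′≤p p≤i = trans (Σ-split 1 (suc c₀) p u (s≤s z≤n) c′≤p)
                                  (trans (cong (Σ[ 1 ⋯ suc c₀ ] u +_) (Σ-≡0 (suc (suc c₀)) p u (λ x c′<x x≤p → upperLeft x c′<x (≤-trans x≤p p≤i))))
                                         (+-identityʳ _))

      v-suffix : ∀ p → 1 ≤ p → p ≤ suc c₀ → Σ[ p ⋯ i ] v ≡ Σ[ suc c₀ ⋯ i ] v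
      v-suffix p 1≤p p≤c′ = trans (Σ-split p c₀ i v p≤c′ (≤-trans (n≤1+n c₀) c≤i))
                                  (cong (_+ Σ[ suc c₀ ⋯ i ] v) (Σ-≡0 p c₀ v (λ x p≤x x≤c₀ → lowerRight x (≤-trans 1≤p p≤x) (s≤s x≤c₀))))

    separated-isFirstMax : IsFirstMax (T A ℓ) 1 i (suc c₀)
    separated-isFirstMax = record { lower = s≤s z≤n ; upper = c≤i ; maximal = maximal ; before = before }
      where
        before : ∀ p → 1 ≤ p → p < suc c₀ → T A ℓ p < T A ℓ (suc c₀)
        before p 1≤p p<c′ = subst (T A ℓ p <_) (cong (_+ Σ[ suc c₀ ⋯ i ] v) (sym (Σ-last 1 c₀ u (s≤s z≤n))))
          (subst (_< Σ[ 1 ⋯ c₀ ] u + u (suc c₀) + Σ[ suc c₀ ⋯ i ] v) (cong (Σ[ 1 ⋯ p ] u +_) (sym (v-suffix p 1≤p (<⇒≤ p<c′))))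
            (+-monoˡ-< (Σ[ suc c₀ ⋯ i ] v) (≤-<-trans (Σ-prefix-mono u (≤-pred p<c′)) (m<m+n _ source>0))))
        maximal : ∀ p → 1 ≤ p → p ≤ i → T A ℓ p ≤ T A ℓ (suc c₀)
        maximal p 1≤p p≤i with p <? suc c₀
        ... | yes p<c′ = <⇒≤ (before p 1≤p p<c′)
        ... | no  p≮c′ = subst (_≤ T A ℓ (suc c₀)) (cong (_+ Σ[ p ⋯ i ] v) (sym (u-prefix p (≮⇒≥ p≮c′) p≤i)))
                           (+-monoʳ-≤ (Σ[ 1 ⋯ suc c₀ ] u) (Σ-suffix-antitone v i (≮⇒≥ p≮c′)))

    separated-φ : ∀ {N} → rowSum A ℓ′ ≡ suc N → φ ℓ A ≡ ℤ.+ suc N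
    separated-φ {N} total = begin
      φ ℓ A                                        ≡⟨ φ-above i<ℓ A ⟩
      Σ[ 1 ⋯ p₊ A ℓ ] u ⊖ Σ[ 1 ⋯ p₊ A ℓ ∸ 1 ] v    ≡⟨ cong (λ p → Σ[ 1 ⋯ p ] u ⊖ Σ[ 1 ⋯ p ∸ 1 ] v) (pSmall-unique separated-isFirstMax) ⟩
      Σ[ 1 ⋯ suc c₀ ] u ⊖ Σ[ 1 ⋯ c₀ ] v            ≡⟨ cong₂ _⊖_ (trans (sym (u-prefix i c≤i ≤-refl)) (trans total (sym (+-identityʳ _))))
                                                               (Σ-≡0 1 c₀ v (λ x 1≤x x≤c₀ → lowerRight x 1≤x (s≤s x≤c₀))) ⟩
      (suc N + 0) ⊖ 0                              ≡⟨ ⊖-+ (suc N) 0 ⟩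
      ℤ.+ suc N                                    ∎
      where open ≡-Reasoning

  pivot : ∀ {A c N} → rowSum A ℓ′ ≡ suc N → Separated A c → ∃ (Pivot A N)
  pivot {A} {c} {N} total sep with lastPositive u c (subst (0 <_) (sym total-c) z<s)
    where
      open Separated sep
      u = λ x → A x ℓ′
      total-c : Σ[ 1 ⋯ c ] u ≡ suc N
      total-c = trans (sym (trans (Σ-split 1 c i u (s≤s z≤n) c≤i) (trans (cong (Σ[ 1 ⋯ c ] u +_) (Σ-≡0 (suc c) i u upperLeft)) (+-identityʳ _)))) total
  ... | suc c₀ , lp = suc c₀ , record
    { 1≤c′ = 1≤x ; source>0 = f>0 ; separated = sep′
    ; p₊≡ = pSmall-unique (separated-isFirstMax sep′ f>0) ; φ≡ = separated-φ sep′ f>0 total }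
    where
      open LastPositive lp
      open Separated sep
      sep′ : Separated A (suc c₀)
      sep′ = record { c≤i = ≤-trans x≤c c≤i ; upperLeft = upperLeft′ ; lowerRight = λ x 1≤x x<c′ → lowerRight x 1≤x (<-≤-trans x<c′ x≤c) }
        where
          upperLeft′ : ∀ x → suc c₀ < x → x ≤ i → A x ℓ′ ≡ 0
          upperLeft′ x c′<x x≤i with x ≤? c
          ... | yes x≤c′ = zeroAfter x c′<x x≤c′
          ... | no  x≰c  = upperLeft x (≰⇒> x≰c) x≤i

  record RowMoved (A C : Arr) : Set where
    field
      columnTotal  : ∀ x → C x ℓ′ + C x ℓ ≡ A x ℓ′ + A x ℓ
      emptied      : ∀ x → 1 ≤ x → x ≤ i → C x ℓ′ ≡ 0
      otherRows    : ∀ x y → y ≢ ℓ′ → y ≢ ℓ → C x y ≡ A x y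
      outerColumns : ∀ x y → x ≡ 0 ⊎ i < x → C x y ≡ A x y

  rowMove-rowMoved : ∀ {A B C c′} → 1 ≤ c′ → c′ ≤ i → RowMove A B c′ ℓ′ ℓ → RowMoved B C → RowMoved A C
  rowMove-rowMoved {A} {B} {c′ = c′} 1≤c′ c′≤i mv moved = record
    { columnTotal  = λ x → trans (columnTotal x) (columnTotal₁ x)
    ; emptied      = emptied
    ; otherRows    = λ x y y≢ℓ′ y≢ℓ → trans (otherRows x y y≢ℓ′ y≢ℓ) (otherRows₁ x y y≢ℓ′ y≢ℓ)
    ; outerColumns = λ x y out → trans (outerColumns x y out) (RowMove.otherCol mv x y (outer≢c′ out)) }
    where
      open RowMoved moved
      columnTotal₁ : ∀ x → B x ℓ′ + B x ℓ ≡ A x ℓ′ + A x ℓ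
      columnTotal₁ x with x ≟ c′
      ... | yes refl = trans (cong (B x ℓ′ +_) (RowMove.dst-suc mv)) (trans (+-suc _ _) (cong (_+ A x ℓ) (sym (RowMove.src-suc mv))))
      ... | no x≢c′ = cong₂ _+_ (RowMove.otherCol mv x ℓ′ x≢c′) (RowMove.otherCol mv x ℓ x≢c′)
      otherRows₁ : ∀ x y → y ≢ ℓ′ → y ≢ ℓ → B x y ≡ A x y
      otherRows₁ x y y≢ℓ′ y≢ℓ with x ≟ c′
      ... | yes refl = RowMove.otherRow mv y y≢ℓ′ y≢ℓ
      ... | no x≢c′ = RowMove.otherCol mv x y x≢c′
      outer≢c′ : ∀ {x} → x ≡ 0 ⊎ i < x → x ≢ c′
      outer≢c′ (inj₁ refl) e = <-irrefl e 1≤c′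
      outer≢c′ (inj₂ i<x) refl = <-irrefl refl (≤-<-trans c′≤i i<x)

  f-above-iterate : ∀ N {A c} → rowSum A ℓ′ ≡ N → Separated A c → ∃ λ C → iter (f ℓ) N A ≡ just C × RowMoved A C
  f-above-iterate zero {A} total _ = A , refl , record
    { columnTotal = λ _ → refl ; emptied = Σ≡0⇒term≡0 1 i (λ x → A x ℓ′) total
    ; otherRows = λ _ _ _ _ → refl ; outerColumns = λ _ _ _ → refl }
  f-above-iterate (suc N) {A} total sep =
    C , trans (cong (_>>= iter (f ℓ) N) (f-defined ℓ A φ≡ z<s)) fᴺC₁ , rowMove-rowMoved 1≤c′ (Separated.c≤i separated) mv (proj₂ (proj₂ rest))
    where
      c′ = proj₁ (pivot total sep)
      open Pivot (proj₂ (pivot total sep))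
      C₁ = fMove ℓ A
      mv : RowMove A C₁ c′ ℓ′ ℓ
      mv = subst (λ C → RowMove A C c′ ℓ′ ℓ) (sym (trans (fMove-above i<ℓ A) (cong (λ p → inc (dec A p ℓ′) p ℓ) p₊≡)))
                 (dec-inc-rowMove A c′ ℓ′ ℓ (λ e → <-irrefl e ≤-refl) source>0)
      total₁ : rowSum C₁ ℓ′ ≡ N
      total₁ = suc-injective (trans (sym (Σ-suc 1 i (λ x → C₁ x ℓ′) c′ 1≤c′ (Separated.c≤i separated) (RowMove.src-suc mv)
                                                   (λ y y≢c′ → sym (RowMove.otherCol mv y ℓ′ y≢c′)))) total)
      sep₁ : Separated C₁ c′
      sep₁ = record
        { c≤i = Separated.c≤i separated
        ; upperLeft  = λ x c′<x x≤i → trans (RowMove.otherCol mv x ℓ′ (>⇒≢ c′<x)) (Separated.upperLeft separated x c′<x x≤i)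
        ; lowerRight = λ x 1≤x x<c′ → trans (RowMove.otherCol mv x ℓ (<⇒≢ x<c′)) (Separated.lowerRight separated x 1≤x x<c′) }
      rest = f-above-iterate N total₁ sep₁
      C = proj₁ rest
      fᴺC₁ = proj₁ (proj₂ rest)

  fφ-above : ∀ {A} → 0 < rowSum A ℓ′ → Separated A i → ∃ λ C → fφ ℓ A ≡ just C × RowMoved A C
  fφ-above {A} pos sep = C , trans (fφ-value ℓ A (Pivot.φ≡ (proj₂ (pivot total sep)))) fᴺA , proj₂ (proj₂ iterated)
    where
      N = pred (rowSum A ℓ′)
      total : rowSum A ℓ′ ≡ suc N
      total = sym (suc-pred _ {{>-nonZero pos}})
      iterated = f-above-iterate (suc N) total sep
      C = proj₁ iterated
      fᴺA : iter (f ℓ) (suc N) A ≡ just C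
      fᴺA = proj₁ (proj₂ iterated)

-- Dyck paths

module DyckPaths (i n : ℕ) where

  Path : ℕ → ℕ → Set
  Path = DyckFrom i n

  pathSum-mono : ∀ {A B : Arr} → (∀ x y → A x y ≤ B x y) → ∀ {a b} (γ : Path a b) → pathSum A γ ≤ pathSum B γ
  pathSum-mono A≤B stop      = A≤B _ _
  pathSum-mono A≤B (right γ) = +-mono-≤ (A≤B _ _) (pathSum-mono A≤B γ)
  pathSum-mono A≤B (down γ)  = +-mono-≤ (A≤B _ _) (pathSum-mono A≤B γ)

  pathSum-subst : ∀ A {a a′ b b′} (e₁ : a ≡ a′) (e₂ : b ≡ b′) (γ : Path a b) → pathSum A (subst₂ Path e₁ e₂ γ) ≡ pathSum A γ
  pathSum-subst A refl refl γ = refl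

  prependRights : ∀ {a b} d → Path a (d + b) → Path a b
  prependRights zero    γ = γ
  prependRights (suc d) γ = prependRights d (right γ)

  pathSum-prependRights : ∀ A {a b} d (γ : Path a (d + b)) → pathSum A (prependRights d γ) ≡ sumFrom (A a) b d + pathSum A γ
  pathSum-prependRights A         zero    γ = refl
  pathSum-prependRights A {a} {b} (suc d) γ = begin
    pathSum A (prependRights d (right γ))                        ≡⟨ pathSum-prependRights A d (right γ) ⟩
    sumFrom (A a) b d + (A a (d + b) + pathSum A γ)         ≡⟨ +-assoc (sumFrom (A a) b d) _ _ ⟨
    sumFrom (A a) b d + A a (d + b) + pathSum A γ           ≡⟨ cong (_+ pathSum A γ) (sumFrom-last (A a) b d) ⟨
    sumFrom (A a) b (suc d) + pathSum A γ                   ∎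
    where open ≡-Reasoning

  prependDowns : ∀ {a q} d → Path (d + a) q → Path a q
  prependDowns zero    γ = γ
  prependDowns (suc d) γ = prependDowns d (down γ)

  pathSum-prependDowns : ∀ A {a q} d (γ : Path (d + a) q) → pathSum A (prependDowns d γ) ≡ sumFrom (λ x → A x q) a d + pathSum A γ
  pathSum-prependDowns A         zero    γ = refl
  pathSum-prependDowns A {a} {q} (suc d) γ = begin
    pathSum A (prependDowns d (down γ))                          ≡⟨ pathSum-prependDowns A d (down γ) ⟩
    sumFrom r a d + (A (d + a) q + pathSum A γ)             ≡⟨ +-assoc (sumFrom r a d) _ _ ⟨
    sumFrom r a d + A (d + a) q + pathSum A γ               ≡⟨ cong (_+ pathSum A γ) (sumFrom-last r a d) ⟨
    sumFrom r a (suc d) + pathSum A γ                       ∎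
    where
      open ≡-Reasoning
      r = λ x → A x q

  rightsThenDown : ∀ A {a b c} → b ≤ c → (β : Path (suc a) c) →
                    ∃ λ (δ : Path a b) → pathSum A δ ≡ Σ[ b ⋯ c ] (λ y → A a y) + pathSum A β
  rightsThenDown A {a} {b} {c} b≤c β = prependRights (c ∸ b) (subst₂ Path refl (sym (m∸n+n≡m b≤c)) (down β)) , (begin
    pathSum A (prependRights (c ∸ b) β′)                          ≡⟨ pathSum-prependRights A (c ∸ b) β′ ⟩
    sumFrom (A a) b (c ∸ b) + pathSum A β′                   ≡⟨ cong (sumFrom (A a) b (c ∸ b) +_) (pathSum-subst A refl (sym (m∸n+n≡m b≤c)) (down β)) ⟩
    sumFrom (A a) b (c ∸ b) + (A a c + pathSum A β)          ≡⟨ +-assoc (sumFrom (A a) b (c ∸ b)) _ _ ⟨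
    sumFrom (A a) b (c ∸ b) + A a c + pathSum A β            ≡⟨ cong (_+ pathSum A β) (Σ-sumFrom-last b c (A a) b≤c) ⟨
    Σ[ b ⋯ c ] (λ y → A a y) + pathSum A β                   ∎)
    where
      open ≡-Reasoning
      β′ = subst₂ Path refl (sym (m∸n+n≡m b≤c)) (down β)

  rightsToEnd : ∀ A {p} → p ≤ n → ∃ λ (δ : Path i p) → pathSum A δ ≡ Σ[ p ⋯ n ] (λ y → A i y)
  rightsToEnd A {p} p≤n = prependRights (n ∸ p) stop′ , (begin
    pathSum A (prependRights (n ∸ p) stop′)                       ≡⟨ pathSum-prependRights A (n ∸ p) stop′ ⟩
    sumFrom (A i) p (n ∸ p) + pathSum A stop′                ≡⟨ cong (sumFrom (A i) p (n ∸ p) +_) (pathSum-subst A refl (sym (m∸n+n≡m p≤n)) stop) ⟩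
    sumFrom (A i) p (n ∸ p) + A i n                          ≡⟨ Σ-sumFrom-last p n (A i) p≤n ⟨
    Σ[ p ⋯ n ] (λ y → A i y)                                 ∎)
    where
      open ≡-Reasoning
      stop′ = subst₂ Path refl (sym (m∸n+n≡m p≤n)) stop

  somePath : ∀ {a b} → a ≤ i → b ≤ n → Path a b
  somePath {a} {b} a≤i b≤n = prependDowns (i ∸ a) (subst₂ Path (sym (m∸n+n≡m a≤i)) refl (prependRights (n ∸ b) (subst₂ Path refl (sym (m∸n+n≡m b≤n)) stop)))

  pathSum-head : ∀ {A B : Arr} → (∀ x y → A x y ≤ B x y) → ∀ {a b c} (γ : Path a b) → A a b + c ≤ B a b → pathSum A γ + c ≤ pathSum B γ
  pathSum-head A≤B stop      h = h
  pathSum-head {A} {B} A≤B {a} {b} {c} (right γ) h = subst (_≤ B a b + pathSum B γ) (xy∙z≈xz∙y (A a b) c (pathSum A γ)) (+-mono-≤ h (pathSum-mono A≤B γ))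
  pathSum-head {A} {B} A≤B {a} {b} {c} (down γ)  h = subst (_≤ B a b + pathSum B γ) (xy∙z≈xz∙y (A a b) c (pathSum A γ)) (+-mono-≤ h (pathSum-mono A≤B γ))

-- Reconstructing Q

column-position : ∀ j p → (p ≡ 0 ⊎ j < p) ⊎ (1 ≤ p × p ≤ j)
column-position j zero    = inj₁ (inj₁ refl)
column-position j (suc p) with suc p ≤? j
... | yes p<j = inj₂ (s≤s z≤n , p<j)
... | no  p≮j = inj₁ (inj₂ (≰⇒> p≮j))

module Setting
  (n i m : ℕ) (1≤i : 1 ≤ i) (i≤n : i ≤ n) (Q : Arr) (Q∈B : InB n i m Q)
  (k : ℕ) (i≤k : i ≤ k) (k≤n : k ≤ n) (rowsAbove : ∀ q → i ≤ q → q < k → ∀ p → Q p q ≡ 0)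
  (t : ℕ) (1≤t : 1 ≤ t) (t≤i : t ≤ i) (Qtk≢0 : Q t k ≢ 0) (leftOf-t : ∀ p → 1 ≤ p → p < t → Q p k ≡ 0)
  where

  open DyckPaths i n

  R : Arr
  R = zeroRow Q k

  r : ℕ → ℕ
  r p = Q p k

  S : ℕ → ℕ
  S j = Σ[ 1 ⋯ j ] r

  -- Q⟨ ℓ ⟩ is Q with its row k moved to row ℓ, i.e. R with r written into row ℓ.
  Q⟨_⟩ : ℕ → Arr
  Q⟨ ℓ ⟩ x y = if y ≡ᵇ ℓ then r x else R x y

  Q⟨⟩-at : ∀ ℓ x → Q⟨ ℓ ⟩ x ℓ ≡ r x
  Q⟨⟩-at ℓ x rewrite ≡ᵇ-refl ℓ = refl

  Q⟨⟩-off : ∀ ℓ x y → y ≢ ℓ → Q⟨ ℓ ⟩ x y ≡ R x y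
  Q⟨⟩-off ℓ x y y≢ℓ rewrite ≢⇒≡ᵇ-false y ℓ y≢ℓ = refl

  R-k : ∀ x → R x k ≡ 0
  R-k x rewrite ≡ᵇ-refl k = refl

  R-off : ∀ x y → y ≢ k → R x y ≡ Q x y
  R-off x y y≢k rewrite ≢⇒≡ᵇ-false y k y≢k = refl

  R≤Q : ∀ x y → R x y ≤ Q x y
  R≤Q x y with y ≟ k
  ... | yes refl = subst (_≤ Q x k) (sym (R-k x)) z≤n
  ... | no  y≢k  = ≤-reflexive (R-off x y y≢k)

  R-rows≤k : ∀ x y → i ≤ y → y ≤ k → R x y ≡ 0
  R-rows≤k x y i≤y y≤k with y ≟ k
  ... | yes refl = R-k x
  ... | no  y≢k  = trans (R-off x y y≢k) (rowsAbove y i≤y (≤∧≢⇒< y≤k y≢k) x)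

  R-row-i : ∀ x → R x i ≡ 0
  R-row-i x = R-rows≤k x i ≤-refl i≤k

  Outer : ℕ → Set
  Outer x = x ≡ 0 ⊎ i < x

  private
    Outer⇒out : ∀ {x} y → Outer x → ¬ InRange n i x y
    Outer⇒out _ (inj₁ refl) (1≤0 , _) = <-irrefl refl 1≤0
    Outer⇒out _ (inj₂ i<x) (_ , x≤i , _) = <-irrefl refl (<-≤-trans i<x x≤i)

  Q-outer : ∀ x y → Outer x → Q x y ≡ 0
  Q-outer x y out = InB.zeroOutside Q∈B x y (Outer⇒out y out)

  R-outer : ∀ x y → Outer x → R x y ≡ 0
  R-outer x y out = n≤0⇒n≡0 (subst (R x y ≤_) (Q-outer x y out) (R≤Q x y))

  Q⟨⟩-outer : ∀ ℓ x y → Outer x → Q⟨ ℓ ⟩ x y ≡ 0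
  Q⟨⟩-outer ℓ x y out with y ≟ ℓ
  ... | yes refl = trans (Q⟨⟩-at ℓ x) (Q-outer x k out)
  ... | no  y≢ℓ  = trans (Q⟨⟩-off ℓ x y y≢ℓ) (R-outer x y out)

  Q⟨⟩-zero-r : ∀ ℓ x y → i ≤ ℓ → ℓ ≤ k → r x ≡ 0 → Q⟨ ℓ ⟩ x y ≡ R x y
  Q⟨⟩-zero-r ℓ x y i≤ℓ ℓ≤k rx≡0 with y ≟ ℓ
  ... | yes refl = trans (Q⟨⟩-at ℓ x) (trans rx≡0 (sym (R-rows≤k x y i≤ℓ ℓ≤k)))
  ... | no  y≢ℓ  = Q⟨⟩-off ℓ x y y≢ℓ

  Q⟨k⟩≋Q : Q⟨ k ⟩ ≋ Q
  Q⟨k⟩≋Q x y with y ≟ k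
  ... | yes refl = Q⟨⟩-at k x
  ... | no  y≢k  = trans (Q⟨⟩-off k x y y≢k) (R-off x y y≢k)

  private
    toRow-k : ∀ {a b} (γ : Path a b) → i ≤ b → b ≤ k → ∃ λ (γ′ : Path a k) → pathSum R γ ≤ pathSum R γ′
    toRow-k {a} {b} γ i≤b b≤k with b ≟ k
    toRow-k γ         i≤b b≤k | yes refl = γ , ≤-refl
    toRow-k stop      i≤b b≤k | no  b≢k  = ⊥-elim (b≢k (≤-antisym b≤k k≤n))
    toRow-k {a} {b} (right γ) i≤b b≤k | no b≢k with toRow-k γ (m≤n⇒m≤1+n i≤b) (≤∧≢⇒< b≤k b≢k)
    ... | γ′ , le = γ′ , subst (_≤ pathSum R γ′) (sym (cong (_+ pathSum R γ) (R-rows≤k a b i≤b b≤k))) le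
    toRow-k {a} {b} (down γ)  i≤b b≤k | no b≢k with toRow-k γ i≤b b≤k
    ... | γ′ , le = down γ′ , subst (_≤ R a k + pathSum R γ′) (sym (cong (_+ pathSum R γ) (R-rows≤k a b i≤b b≤k))) (≤-trans le (m≤n+m _ _))

  -- Entering row k through column 1 and following row k to column j turns a path of R starting at (j, i)
  -- into a Dyck path of Q that additionally collects q_{1,k}, …, q_{j,k}.
  S+pathSum≤m : ∀ j → 1 ≤ j → (γ : Path j i) → S j + pathSum R γ ≤ m
  S+pathSum≤m j 1≤j γ = begin
    S j + pathSum R γ                            ≤⟨ +-monoʳ-≤ (S j) γ≤γ′ ⟩
    S j + pathSum R γ′                           ≡⟨ cong (_+ pathSum R γ′) (Σ-sumFrom-last 1 j r 1≤j) ⟩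
    sumFrom r 1 (j ∸ 1) + r j + pathSum R γ′     ≡⟨ xy∙z≈xz∙y (sumFrom r 1 (j ∸ 1)) (r j) (pathSum R γ′) ⟩
    sumFrom r 1 (j ∸ 1) + pathSum R γ′ + r j     ≡⟨ +-assoc (sumFrom r 1 (j ∸ 1)) _ _ ⟩
    sumFrom r 1 (j ∸ 1) + (pathSum R γ′ + r j)   ≤⟨ +-monoʳ-≤ (sumFrom r 1 (j ∸ 1)) (pathSum-head R≤Q γ′ (≤-reflexive (cong (_+ r j) (R-k j)))) ⟩
    sumFrom r 1 (j ∸ 1) + pathSum Q γ′           ≡⟨ cong (sumFrom r 1 (j ∸ 1) +_) (pathSum-subst Q (sym j-1+1) refl γ′) ⟨
    sumFrom r 1 (j ∸ 1) + pathSum Q γ″           ≡⟨ pathSum-prependDowns Q (j ∸ 1) γ″ ⟨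
    pathSum Q (prependDowns (j ∸ 1) γ″)               ≤⟨ m≤n+m _ _ ⟩
    sumFrom (Q 1) i (k ∸ i) + pathSum Q (prependDowns (j ∸ 1) γ″)  ≡⟨ cong (sumFrom (Q 1) i (k ∸ i) +_) (pathSum-subst Q refl (sym k-i+i) (prependDowns (j ∸ 1) γ″)) ⟨
    sumFrom (Q 1) i (k ∸ i) + pathSum Q δ′       ≡⟨ pathSum-prependRights Q (k ∸ i) δ′ ⟨
    pathSum Q (prependRights (k ∸ i) δ′)              ≤⟨ InB.dyck Q∈B (prependRights (k ∸ i) δ′) ⟩
    m                                            ∎
    where
      open ≤-Reasoning
      γ′ = proj₁ (toRow-k γ ≤-refl i≤k)
      γ≤γ′ = proj₂ (toRow-k γ ≤-refl i≤k)
      j-1+1 = m∸n+n≡m 1≤j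
      k-i+i = m∸n+n≡m i≤k
      γ″ = subst₂ Path (sym j-1+1) refl γ′
      δ′ = subst₂ Path refl (sym k-i+i) (prependDowns (j ∸ 1) γ″)

  open Crystal n i m
  open Operators n i m
  open Iteration n i m
  open ColumnPair n i m 1≤i i≤n

  -- E ∘ F regrouped into nested layers (EF-columnSweep), the layer of column t + d enclosing those left of it.
  columnSweep : ℕ → Arr → Maybe Arr
  columnSweep zero    X = iter (f t) (r t) X
  columnSweep (suc d) X = fφ (suc d + t) X >>= λ Y → columnSweep d Y >>= eε- (suc d + t) (r (suc d + t))

  record Ready (j : ℕ) (X : Arr) : Set where
    field
      untouched : ∀ p q → 1 ≤ p → p ≤ j → X p q ≡ R p q
      full      : colSum X (suc j) ≡ m
      bounded   : ∀ p → i < p → p ≤ n → ∃ λ (β : Path (suc j) p) → Σ[ p ⋯ n ] (λ y → X (suc j) y) ≤ pathSum R β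

  -- The layers of columns t, …, j have put q_{1,k}, …, q_{j,k} into row i, taking S j units from (j + 1, i).
  record Swept (j : ℕ) (X Y : Arr) : Set where
    field
      done     : ∀ p q → 1 ≤ p → p ≤ j → Y p q ≡ Q⟨ i ⟩ p q
      top      : Y (suc j) i ≡ X (suc j) i ∸ S j
      nextRest : ∀ q → q ≢ i → Y (suc j) q ≡ X (suc j) q
      outer    : ∀ p q → p ≡ 0 ⊎ suc j < p → Y p q ≡ X p q

  record Lead (j : ℕ) (X : Arr) : Set where
    field
      enough : S j ≤ X (suc j) i
      margin : ∀ y → i < y → y ≤ n → U X j y + S j ≤ U X j i
      U-i≡m  : U X j i ≡ m

  ready⇒lead : ∀ {j X} → 1 ≤ j → j < i → Ready j X → Lead j X
  ready⇒lead {j} {X} 1≤j j<i ready = record { enough = enough ; margin = margin ; U-i≡m = U-i≡m }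
    where
      open Ready ready
      w = λ y → X (suc j) y
      U-i≡m : U X j i ≡ m
      U-i≡m = trans (cong (_+ colSum X (suc j)) (trans (Σ-single i (λ y → X j y)) (trans (untouched j i 1≤j ≤-refl) (R-row-i j)))) full
      margin : ∀ y → i < y → y ≤ n → U X j y + S j ≤ U X j i
      margin y i<y y≤n = begin
        U X j y + S j                                                ≤⟨ +-monoˡ-≤ (S j) (+-mono-≤ (≤-reflexive (Σ-cong i y _ (λ z _ _ → untouched j z 1≤j ≤-refl))) β-bound) ⟩
        Σ[ i ⋯ y ] (λ z → R j z) + pathSum R β + S j                 ≡⟨ cong (_+ S j) (proj₂ (rightsThenDown R (<⇒≤ i<y) β)) ⟨
        pathSum R δ + S j                                            ≡⟨ +-comm (pathSum R δ) (S j) ⟩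
        S j + pathSum R δ                                            ≤⟨ S+pathSum≤m j 1≤j δ ⟩
        m                                                            ≡⟨ U-i≡m ⟨
        U X j i                                                      ∎
        where
          open ≤-Reasoning
          β = proj₁ (bounded y i<y y≤n)
          β-bound = proj₂ (bounded y i<y y≤n)
          δ = proj₁ (rightsThenDown R (<⇒≤ i<y) β)
      S+tail≤m : S j + Σ[ suc i ⋯ n ] w ≤ m
      S+tail≤m with m≤n⇒m<n∨m≡n i≤n
      ... | inj₁ i<n = ≤-trans (+-monoʳ-≤ (S j) (≤-trans β-bound (≤-trans (m≤n+m _ (R (suc j) i)) (m≤n+m _ (R j i)))))
                               (S+pathSum≤m j 1≤j (down (right β)))
        where
          β = proj₁ (bounded (suc i) ≤-refl i<n)
          β-bound = proj₂ (bounded (suc i) ≤-refl i<n)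
      ... | inj₂ i≡n = subst (λ x → S j + x ≤ m) (sym (Σ-empty (suc i) n w (subst (_< suc i) i≡n ≤-refl)))
                             (≤-trans (≤-reflexive (+-identityʳ (S j))) (≤-trans (m≤m+n _ _) (S+pathSum≤m j 1≤j (somePath (<⇒≤ j<i) i≤n))))
      enough : S j ≤ X (suc j) i
      enough = +-cancelʳ-≤ (Σ[ suc i ⋯ n ] w) (S j) (w i) (subst (S j + Σ[ suc i ⋯ n ] w ≤_) (trans (sym full) (Σ-first i n w i≤n)) S+tail≤m)

  S-t : S t ≡ r t
  S-t = trans (Σ-sumFrom-last 1 t r 1≤t) (cong (_+ r t) (sumFrom-≡0 r 1 (t ∸ 1) left-zero))
    where
      left-zero : ∀ x → 1 ≤ x → x < 1 + (t ∸ 1) → r x ≡ 0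
      left-zero x 1≤x x<t = leftOf-t x 1≤x (subst (x <_) (m+[n∸m]≡n 1≤t) x<t)

  r-off-t : ∀ p → p ≢ t → p ≤ t → r p ≡ 0
  r-off-t zero    _   _   = Q-outer 0 k (inj₁ refl)
  r-off-t (suc p) p≢t p≤t = leftOf-t (suc p) (s≤s z≤n) (≤∧≢⇒< p≤t p≢t)

  private
    outer≢ : ∀ {j p x} → p ≡ 0 ⊎ suc j < p → 1 ≤ x → x ≤ suc j → p ≢ x
    outer≢ (inj₁ refl) 1≤x _   refl = <-irrefl refl 1≤x
    outer≢ (inj₂ j<p)  _   x≤j refl = <-irrefl refl (<-≤-trans j<p x≤j)

  sweep-base : t < i → ∀ {X} → Ready t X → ∃ λ Y → columnSweep 0 X ≡ just Y × Swept t X Y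
  sweep-base t<i {X} ready = Y , fʳX , record
    { done     = done
    ; top      = trans (sym (m+n∸n≡m (Y (suc t) i) (r t))) (trans (cong (_∸ r t) (sym src-+)) (cong (X (suc t) i ∸_) (sym S-t)))
    ; nextRest = src-other
    ; outer    = λ p q out → elsewhere p q (outer≢ out (s≤s z≤n) ≤-refl) (outer≢ out 1≤t (n≤1+n t)) }
    where
      open Ready ready
      open Lead (ready⇒lead 1≤t t<i ready)
      moved = f-below-top t<i (r t) X (subst (_≤ X (suc t) i) S-t enough) (λ y i<y y≤n → subst (λ c → U X t y + c ≤ U X t i) S-t (margin y i<y y≤n))
      Y = proj₁ moved
      fʳX = proj₁ (proj₂ moved)
      open Transfer (proj₂ (proj₂ moved))
      column-t : ∀ q → Y t q ≡ Q⟨ i ⟩ t q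
      column-t = agree-split i
        (trans dst-+ (trans (cong (_+ r t) (trans (untouched t i 1≤t ≤-refl) (R-row-i t))) (sym (Q⟨⟩-at i t))))
        (λ q q≢i → trans (dst-other q q≢i) (trans (untouched t q 1≤t ≤-refl) (sym (Q⟨⟩-off i t q q≢i))))
      done : ∀ p q → 1 ≤ p → p ≤ t → Y p q ≡ Q⟨ i ⟩ p q
      done p q 1≤p p≤t = [ (λ p<t → trans (elsewhere p q (<⇒≢ (m<n⇒m<1+n p<t)) (<⇒≢ p<t))
                                          (trans (untouched p q 1≤p p≤t) (sym (Q⟨⟩-zero-r i p q ≤-refl i≤k (leftOf-t p 1≤p p<t)))))
                         , (λ p≡t → subst (λ x → Y x q ≡ Q⟨ i ⟩ x q) (sym p≡t) (column-t q)) ]′ (m≤n⇒m<n∨m≡n p≤t)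

  -- f_j first moves S j units in row i (f-below-top); its remaining moves are those it makes on B, which
  -- lacks these units, and e_j undoes them after the inner layers (e-below-undoes-shifted).
  module SweepStep (j′ : ℕ) (j<i : suc j′ < i) {X : Arr} (ready : Ready (suc j′) X) where
    private
      j = suc j′
      1≤j : 1 ≤ j
      1≤j = s≤s z≤n
      j≢j+1 : j ≢ suc j
      j≢j+1 e = <-irrefl e ≤-refl
      open Ready ready
      open Lead (ready⇒lead 1≤j j<i ready)

    B : Arr
    B = adjust X (suc j) i (_∸ S j)

    private
      B-column : ∀ q → B j q ≡ X j q
      B-column q = adjust-otherCol X (suc j) i (_∸ S j) j q j≢j+1

      B-next-top : B (suc j) i ≡ X (suc j) i ∸ S j
      B-next-top = adjust-here X (suc j) i (_∸ S j)

      B-next-rest : ∀ q → q ≢ i → B (suc j) q ≡ X (suc j) q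
      B-next-rest q q≢i = adjust-otherRow X (suc j) i (_∸ S j) (suc j) q q≢i

      top-moved = f-below-top j<i (S j) X enough margin
      X₁ = proj₁ top-moved
      fˢX : iter (f j) (S j) X ≡ just X₁
      fˢX = proj₁ (proj₂ top-moved)
      module T = Transfer (proj₂ (proj₂ top-moved))

      X₁-next-top : X₁ (suc j) i ≡ X (suc j) i ∸ S j
      X₁-next-top = trans (sym (m+n∸n≡m _ (S j))) (cong (_∸ S j) (sym T.src-+))

      sh₁ : TopShifted j (S j) B X₁
      sh₁ = record
        { top   = trans T.dst-+ (cong (_+ S j) (sym (B-column i)))
        ; below = λ y y≢i → trans (T.dst-other y y≢i) (sym (B-column y))
        ; next  = agree-split i (trans X₁-next-top (sym B-next-top)) (λ y y≢i → trans (T.src-other y y≢i) (sym (B-next-rest y y≢i))) }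

      B-full : colSum B (suc j) + S j ≡ m
      B-full = begin
        colSum B (suc j) + S j                                      ≡⟨ cong (_+ S j) (Σ-first i n _ i≤n) ⟩
        B (suc j) i + Σ[ suc i ⋯ n ] (λ y → B (suc j) y) + S j      ≡⟨ cong₂ (λ a b → a + b + S j) B-next-top (Σ-cong (suc i) n _ (λ y i<y _ → B-next-rest y (>⇒≢ i<y))) ⟩
        X (suc j) i ∸ S j + tail + S j                              ≡⟨ xy∙z≈xz∙y (X (suc j) i ∸ S j) tail (S j) ⟩
        X (suc j) i ∸ S j + S j + tail                              ≡⟨ cong (_+ tail) (m∸n+n≡m enough) ⟩
        X (suc j) i + tail                                          ≡⟨ trans (sym (Σ-first i n _ i≤n)) full ⟩
        m                                                           ∎
        where
          open ≡-Reasoning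
          tail = Σ[ suc i ⋯ n ] (λ y → X (suc j) y)

      U-B-i : U B j i ≡ colSum B (suc j)
      U-B-i = trans (U-first B j) (cong (_+ colSum B (suc j)) (trans (B-column i) (trans (untouched j i 1≤j ≤-refl) (R-row-i j))))

      U-B-y : ∀ y → i < y → U B j y ≡ U X j y
      U-B-y y i<y = cong₂ _+_ (Σ-cong i y _ (λ z _ _ → B-column z)) (Σ-cong y n _ (λ z y≤z _ → B-next-rest z (>⇒≢ (<-≤-trans i<y y≤z))))

      maxU-B : maxU B j ≡ colSum B (suc j)
      maxU-B = trans (maxU-at-i B j U≤) U-B-i
        where
          U≤ : ∀ y → i < y → y ≤ n → U B j y ≤ U B j i
          U≤ y i<y y≤n = +-cancelʳ-≤ (S j) _ _ (subst₂ _≤_ (cong (_+ S j) (sym (U-B-y y i<y))) (trans U-i≡m (sym (trans (cong (_+ S j) U-B-i) B-full))) (margin y i<y y≤n))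

      maxU-X : maxU X j ≡ m
      maxU-X = trans (maxU-at-i X j (λ y i<y y≤n → ≤-trans (m≤m+n _ (S j)) (margin y i<y y≤n))) U-i≡m

    c : ℕ
    c = φℕ B j

    private
      iterated = f-below-iterate j<i c B ≤-refl

    B′ : Arr
    B′ = proj₁ iterated

    fᶜB : iter (f j) c B ≡ just B′
    fᶜB = proj₁ (proj₂ iterated)

    private
      εℕ-B′ : εℕ B′ j ≡ c
      εℕ-B′ = trans (proj₁ (proj₂ (proj₂ iterated))) (trans (cong (c +_) (trans (cong (_∸ colSum B (suc j)) maxU-B) (n∸n≡0 (colSum B (suc j))))) (+-identityʳ c))

      colSum-B′ : colSum B′ j ≡ c + colSum B j
      colSum-B′ = proj₂ (proj₂ (proj₂ iterated))

      shifted = f-below-shifted j<i c fᶜB sh₁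

    X₂ : Arr
    X₂ = proj₁ shifted

    private
      φℕ-X : φℕ X j ≡ S j + c
      φℕ-X = begin
        maxU X j ∸ colSum X j                           ≡⟨ cong₂ _∸_ (trans maxU-X (sym B-full)) (Σ-cong i n _ (λ q _ _ → sym (B-column q))) ⟩
        (colSum B (suc j) + S j) ∸ colSum B j           ≡⟨ +-∸-comm (S j) colSum-B≤ ⟩
        (colSum B (suc j) ∸ colSum B j) + S j           ≡⟨ +-comm _ (S j) ⟩
        S j + (colSum B (suc j) ∸ colSum B j)           ≡⟨ cong (λ x → S j + (x ∸ colSum B j)) maxU-B ⟨
        S j + c                                         ∎
        where
          open ≡-Reasoning
          colSum-B≤ = subst (colSum B j ≤_) maxU-B (colSum≤maxU B j)

    fφ-X : fφ j X ≡ just X₂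
    fφ-X = begin
      fφ j X                                ≡⟨ fφ-value j X (trans (φ-below-value X j j<i) (cong ℤ.+_ φℕ-X)) ⟩
      iter (f j) (S j + c) X                ≡⟨ iter-+ (f j) (S j) c X ⟩
      (iter (f j) (S j) X >>= iter (f j) c) ≡⟨ cong (_>>= iter (f j) c) fˢX ⟩
      iter (f j) c X₁                       ≡⟨ proj₁ (proj₂ shifted) ⟩
      just X₂                               ∎
      where open ≡-Reasoning

    private
      sh₂ : TopShifted j (S j) B′ X₂
      sh₂ = proj₁ (proj₂ (proj₂ shifted))

      fixed₁₂ : ColumnsFixed j X₁ X₂
      fixed₁₂ = proj₂ (proj₂ (proj₂ shifted))

      X₂-bounded : ∀ p → i < p → p ≤ n → ∃ λ (β : Path j p) → Σ[ p ⋯ n ] (λ y → X₂ j y) ≤ pathSum R β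
      X₂-bounded p i<p p≤n = proj₁ δ , (begin
        Σ[ p ⋯ n ] (λ y → X₂ j y)                                       ≡⟨ Σ-cong p n _ (λ y p≤y _ → TopShifted.below sh₂ y (>⇒≢ (<-≤-trans i<p p≤y))) ⟩
        Σ[ p ⋯ n ] (λ y → B′ j y)                                       ≤⟨ m≤m+n _ _ ⟩
        W B′ j p n                                                      ≤⟨ W≤ ⟩
        W B j p y′                                                      ≡⟨ cong₂ _+_ (Σ-cong p y′ _ (λ z _ _ → trans (B-column z) (untouched j z 1≤j ≤-refl)))
                                                                                     (Σ-cong y′ n _ (λ z y′≤z _ → B-next-rest z (>⇒≢ (<-≤-trans i<p (≤-trans p≤y′ y′≤z))))) ⟩
        Σ[ p ⋯ y′ ] (λ z → R j z) + Σ[ y′ ⋯ n ] (λ z → X (suc j) z)     ≤⟨ +-monoʳ-≤ _ (proj₂ (bounded y′ (<-≤-trans i<p p≤y′) y′≤n)) ⟩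
        Σ[ p ⋯ y′ ] (λ z → R j z) + pathSum R β                         ≡⟨ proj₂ δ ⟨
        pathSum R (proj₁ δ)                                             ∎)
        where
          open ≤-Reasoning
          dominated = f-below-wDominated j<i c fᶜB p i<p p≤n n p≤n ≤-refl
          y′ = proj₁ dominated
          p≤y′ = proj₁ (proj₂ dominated)
          y′≤n = proj₁ (proj₂ (proj₂ dominated))
          W≤ = proj₂ (proj₂ (proj₂ dominated))
          β = proj₁ (bounded y′ (<-≤-trans i<p p≤y′) y′≤n)
          δ = rightsThenDown R p≤y′ β

    ready₂ : Ready j′ X₂
    ready₂ = record { untouched = untouched₂ ; full = full₂ ; bounded = X₂-bounded }
      where
        open TopShiftedProperties sh₂
        untouched₂ : ∀ p q → 1 ≤ p → p ≤ j′ → X₂ p q ≡ R p q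
        untouched₂ p q 1≤p p≤j′ = trans (fixed₁₂ p q p≢j p≢j+1) (trans (T.elsewhere p q p≢j+1 p≢j) (untouched p q 1≤p (m≤n⇒m≤1+n p≤j′)))
          where
            p≢j = λ e → <-irrefl e (s≤s p≤j′)
            p≢j+1 = λ e → <-irrefl e (s≤s (m≤n⇒m≤1+n p≤j′))
        full₂ : colSum X₂ j ≡ m
        full₂ = begin
          colSum X₂ j                                 ≡⟨ Σ-column-shift n i≤n ⟩
          colSum B′ j + S j                           ≡⟨ cong (_+ S j) colSum-B′ ⟩
          c + colSum B j + S j                        ≡⟨ cong (_+ S j) (m∸n+n≡m (colSum≤maxU B j)) ⟩
          maxU B j + S j                              ≡⟨ cong (_+ S j) maxU-B ⟩
          colSum B (suc j) + S j                      ≡⟨ B-full ⟩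
          m                                           ∎
          where open ≡-Reasoning

    private
      Y-shifted : ∀ {Y} → Swept j′ X₂ Y → TopShifted j (r j) B′ Y
      Y-shifted {Y} swept = record
        { top = begin
            Y j i                        ≡⟨ W.top ⟩
            X₂ j i ∸ S j′                ≡⟨ cong (_∸ S j′) (TopShifted.top sh₂) ⟩
            B′ j i + S j ∸ S j′          ≡⟨ cong (λ x → B′ j i + x ∸ S j′) (trans (Σ-last 1 j′ r (s≤s z≤n)) (+-comm (S j′) (r j))) ⟩
            B′ j i + (r j + S j′) ∸ S j′ ≡⟨ cong (_∸ S j′) (+-assoc (B′ j i) (r j) (S j′)) ⟨
            B′ j i + r j + S j′ ∸ S j′   ≡⟨ m+n∸n≡m (B′ j i + r j) (S j′) ⟩
            B′ j i + r j                 ∎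
        ; below = λ y y≢i → trans (W.nextRest y y≢i) (TopShifted.below sh₂ y y≢i)
        ; next  = λ y → trans (W.outer (suc j) y (inj₂ ≤-refl)) (TopShifted.next sh₂ y) }
        where
          open ≡-Reasoning
          module W = Swept swept

    finish : ∀ {Y} → Swept j′ X₂ Y → ∃ λ Z → eε- j (r j) Y ≡ just Z × Swept j X Z
    finish {Y} swept = Z , eε-Y , record { done = done ; top = top ; nextRest = nextRest ; outer = outer }
      where
        module W = Swept swept
        sh₃ = Y-shifted swept
        undone = e-below-undoes-shifted j<i c fᶜB sh₃
        Z = proj₁ undone
        fixedYZ : ColumnsFixed j Y Z
        fixedYZ = proj₂ (proj₂ (proj₂ undone))
        sh₄ : TopShifted j (r j) B Z
        sh₄ = proj₁ (proj₂ (proj₂ undone))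
        eε-Y : eε- j (r j) Y ≡ just Z
        eε-Y = trans (eε-value j (r j) Y (trans (ε-below-value Y j j<i) (cong ℤ.+_ (trans (TopShiftedProperties.εℕ-shift sh₃) (cong (_+ r j) εℕ-B′)))))
                     (proj₁ (proj₂ undone))
        column-j : ∀ q → Z j q ≡ Q⟨ i ⟩ j q
        column-j = agree-split i
          (trans (TopShifted.top sh₄) (trans (cong (_+ r j) (trans (B-column i) (trans (untouched j i 1≤j ≤-refl) (R-row-i j)))) (sym (Q⟨⟩-at i j))))
          (λ q q≢i → trans (TopShifted.below sh₄ q q≢i) (trans (B-column q) (trans (untouched j q 1≤j ≤-refl) (sym (Q⟨⟩-off i j q q≢i)))))
        done : ∀ p q → 1 ≤ p → p ≤ j → Z p q ≡ Q⟨ i ⟩ p q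
        done p q 1≤p p≤j = [ (λ p<j → trans (fixedYZ p q (<⇒≢ p<j) (<⇒≢ (m<n⇒m<1+n p<j))) (W.done p q 1≤p (≤-pred p<j)))
                           , (λ p≡j → subst (λ x → Z x q ≡ Q⟨ i ⟩ x q) (sym p≡j) (column-j q)) ]′ (m≤n⇒m<n∨m≡n p≤j)
        top : Z (suc j) i ≡ X (suc j) i ∸ S j
        top = trans (TopShifted.next sh₄ i) B-next-top
        nextRest : ∀ q → q ≢ i → Z (suc j) q ≡ X (suc j) q
        nextRest q q≢i = trans (TopShifted.next sh₄ q) (B-next-rest q q≢i)
        outer : ∀ p q → p ≡ 0 ⊎ suc j < p → Z p q ≡ X p q
        outer p q out = trans (fixedYZ p q p≢j p≢j+1) (trans (W.outer p q out′) (trans (fixed₁₂ p q p≢j p≢j+1) (T.elsewhere p q p≢j+1 p≢j)))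
          where
            p≢j = outer≢ out 1≤j (n≤1+n j)
            p≢j+1 = outer≢ out (s≤s z≤n) ≤-refl
            out′ : p ≡ 0 ⊎ j < p
            out′ = [ inj₁ , (λ j+1<p → inj₂ (<-trans (n<1+n j) j+1<p)) ]′ out

  sweep : ∀ d → d + t < i → ∀ {X} → Ready (d + t) X → ∃ λ Y → columnSweep d X ≡ just Y × Swept (d + t) X Y
  sweep zero    t<i ready = sweep-base t<i ready
  sweep (suc d) j<i {X} ready = Z , sweep-X , proj₂ (proj₂ finished)
    where
      j = suc d + t
      open SweepStep (d + t) j<i ready using (X₂; fφ-X; ready₂; finish)
      inner = sweep d (<-trans (n<1+n _) j<i) ready₂
      Y = proj₁ inner
      finished = finish (proj₂ (proj₂ inner))
      Z = proj₁ finished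
      sweep-X : columnSweep (suc d) X ≡ just Z
      sweep-X = begin
        columnSweep (suc d) X                                  ≡⟨ cong (_>>= λ Y′ → columnSweep d Y′ >>= eε- j (r j)) fφ-X ⟩
        (columnSweep d X₂ >>= eε- j (r j))                     ≡⟨ cong (_>>= eε- j (r j)) (proj₁ (proj₂ inner)) ⟩
        eε- j (r j) Y                                          ≡⟨ proj₁ (proj₂ finished) ⟩
        just Z                                                 ∎
        where open ≡-Reasoning

  open TopEntry n i m 1≤i i≤n

  private
    hook-R : hook R ≡ colSum R i
    hook-R = cong (_+ colSum R i) (Σ-≡0 1 (i ∸ 1) (λ x → R x i) (λ x _ _ → R-row-i x))

    S+hook≤m : S i + hook R ≤ m
    S+hook≤m = subst (λ x → S i + x ≤ m) (trans (proj₂ end) (sym hook-R)) (S+pathSum≤m i 1≤i (proj₁ end))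
      where end = rightsToEnd R i≤n

    ≋Q⟨i⟩ : ∀ {Z} → Z i i ≡ r i → (∀ q → q ≢ i → Z i q ≡ R i q) → (∀ p q → p ≢ i → Z p q ≡ Q⟨ i ⟩ p q) → Z ≋ Q⟨ i ⟩
    ≋Q⟨i⟩ {Z} at off-row off-column p q = agree-split i {λ p → Z p q} {λ p → Q⟨ i ⟩ p q}
      (agree-split i (trans at (sym (Q⟨⟩-at i i))) (λ q q≢i → trans (off-row q q≢i) (sym (Q⟨⟩-off i i q q≢i))) q)
      (λ p p≢i → off-column p q p≢i) p

  sweep-t≡i : t ≡ i → ∃ λ Z → columnSweep 0 R ≡ just Z × Z ≋ Q⟨ i ⟩
  sweep-t≡i t≡i = Z , trans (cong (λ x → iter (f x) (r x) R) t≡i) fʳR ,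
                  ≋Q⟨i⟩ (trans Z-top (trans (cong (_+ r i) (R-row-i i)) refl)) (λ q q≢i → off i q (inj₂ q≢i))
                        (λ p q p≢i → trans (off p q (inj₁ p≢i)) (sym (Q⟨⟩-zero-r i p q ≤-refl i≤k (r-off p p≢i))))
    where
      raised = f-top-iterate (r i) R (≤-trans (+-monoˡ-≤ (hook R) (term≤Σ 1 i r i 1≤i ≤-refl)) S+hook≤m)
      Z = proj₁ raised
      fʳR = proj₁ (proj₂ raised)
      Z-top = proj₁ (proj₂ (proj₂ raised))
      off = proj₂ (proj₂ (proj₂ raised))
      r-off : ∀ p → p ≢ i → r p ≡ 0
      r-off p p≢i with <-cmp p i
      ... | tri< p<i _ _ = r-off-t p (λ p≡t → p≢i (trans p≡t t≡i)) (<⇒≤ (subst (p <_) (sym t≡i) p<i))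
      ... | tri≈ _ p≡i _ = ⊥-elim (p≢i p≡i)
      ... | tri> _ _ i<p = Q-outer p k (inj₂ i<p)

  module SweepTop (jm : ℕ) (j≡i : suc jm ≡ i) where
    private
      c₀ = m ∸ hook R
      c₀+hook≡m : c₀ + hook R ≡ m
      c₀+hook≡m = m∸n+n≡m (≤-trans (m≤n+m _ (S i)) S+hook≤m)
      raised = f-top-iterate c₀ R (≤-reflexive c₀+hook≡m)
      column-i : ∀ (A : Arr) q → A (suc jm) q ≡ A i q
      column-i A q = cong (λ x → A x q) j≡i

    X₁ : Arr
    X₁ = proj₁ raised

    private
      X₁-top : X₁ i i ≡ c₀
      X₁-top = trans (proj₁ (proj₂ (proj₂ raised))) (cong (_+ c₀) (R-row-i i))
      X₁-off : SameOffTop R X₁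
      X₁-off = proj₂ (proj₂ (proj₂ raised))

    fφ-R : fφ i R ≡ just X₁
    fφ-R = trans (fφ-value i R (trans (φ-at refl R) (trans (cong (_⊖ hook R) (sym c₀+hook≡m)) (⊖-+ c₀ (hook R))))) (proj₁ (proj₂ raised))

    ready₁ : Ready jm X₁
    ready₁ = record
      { untouched = λ p q 1≤p p≤jm → X₁-off p q (inj₁ (λ p≡i → <-irrefl (trans p≡i (sym j≡i)) (s≤s p≤jm)))
      ; full = trans (cong (λ x → colSum X₁ x) j≡i) full
      ; bounded = bounded }
      where
        full : colSum X₁ i ≡ m
        full = begin
          colSum X₁ i                                   ≡⟨ Σ-first i n _ i≤n ⟩
          X₁ i i + Σ[ suc i ⋯ n ] (λ y → X₁ i y)        ≡⟨ cong₂ _+_ X₁-top (Σ-cong (suc i) n _ (λ y i<y _ → X₁-off i y (inj₂ (>⇒≢ i<y)))) ⟩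
          c₀ + Σ[ suc i ⋯ n ] (λ y → R i y)             ≡⟨ cong (c₀ +_) (cong (_+ Σ[ suc i ⋯ n ] (λ y → R i y)) (sym (R-row-i i))) ⟩
          c₀ + (R i i + Σ[ suc i ⋯ n ] (λ y → R i y))   ≡⟨ cong (c₀ +_) (trans (sym (Σ-first i n _ i≤n)) (sym hook-R)) ⟩
          c₀ + hook R                                   ≡⟨ c₀+hook≡m ⟩
          m                                             ∎
          where open ≡-Reasoning
        bounded : ∀ p → i < p → p ≤ n → ∃ λ (β : Path (suc jm) p) → Σ[ p ⋯ n ] (λ y → X₁ (suc jm) y) ≤ pathSum R β
        bounded p i<p p≤n = subst₂ Path (sym j≡i) refl (proj₁ end) , subst₂ _≤_
          (Σ-cong p n _ (λ y p≤y _ → sym (trans (column-i X₁ y) (X₁-off i y (inj₂ (>⇒≢ (<-≤-trans i<p p≤y)))))))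
          (sym (pathSum-subst R (sym j≡i) refl (proj₁ end)))
          (≤-reflexive (sym (proj₂ end)))
          where end = rightsToEnd R p≤n

    private
      a₀ = c₀ ∸ S i

      Y-top : ∀ {Y} → Swept jm X₁ Y → Y i i ≡ a₀ + r i
      Y-top {Y} swept = begin
        Y i i                  ≡⟨ column-i Y i ⟨
        Y (suc jm) i           ≡⟨ Swept.top swept ⟩
        X₁ (suc jm) i ∸ S jm   ≡⟨ cong (_∸ S jm) (trans (column-i X₁ i) (trans X₁-top c₀≡)) ⟩
        a₀ + r i + S jm ∸ S jm ≡⟨ m+n∸n≡m (a₀ + r i) (S jm) ⟩
        a₀ + r i               ∎
        where
          open ≡-Reasoning
          S-i : S i ≡ S jm + r i
          S-i = trans (cong S (sym j≡i)) (trans (Σ-last 1 jm r (s≤s z≤n)) (cong (λ x → S jm + r x) j≡i))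
          c₀≡ : c₀ ≡ a₀ + r i + S jm
          c₀≡ = begin
            c₀                    ≡⟨ m∸n+n≡m (subst (_≤ c₀) (m+n∸n≡m (S i) (hook R)) (∸-monoˡ-≤ (hook R) S+hook≤m)) ⟨
            a₀ + S i              ≡⟨ cong (a₀ +_) (trans S-i (+-comm (S jm) (r i))) ⟩
            a₀ + (r i + S jm)     ≡⟨ +-assoc a₀ (r i) (S jm) ⟨
            a₀ + r i + S jm       ∎

    finish : ∀ {Y} → Swept jm X₁ Y → ∃ λ Z → eε- i (r i) Y ≡ just Z × Z ≋ Q⟨ i ⟩
    finish {Y} swept = Z , eε-Y , ≋Q⟨i⟩ Z-top Z-row Z-column
      where
        module W = Swept swept
        lowered = e-top-iterate a₀ Y (subst (a₀ ≤_) (sym (Y-top swept)) (m≤m+n a₀ (r i)))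
        Z = proj₁ lowered
        Z-off = proj₂ (proj₂ (proj₂ lowered))
        eε-Y : eε- i (r i) Y ≡ just Z
        eε-Y = trans (eε-value i (r i) Y (trans (ε-at refl Y) (cong ℤ.+_ (Y-top swept)))) (proj₁ (proj₂ lowered))
        Z-top : Z i i ≡ r i
        Z-top = +-cancelʳ-≡ a₀ (Z i i) (r i) (trans (sym (proj₁ (proj₂ (proj₂ lowered)))) (trans (Y-top swept) (+-comm a₀ (r i))))
        Z-row : ∀ q → q ≢ i → Z i q ≡ R i q
        Z-row q q≢i = trans (Z-off i q (inj₂ q≢i))
                        (trans (sym (column-i Y q)) (trans (W.nextRest q q≢i) (trans (column-i X₁ q) (X₁-off i q (inj₂ q≢i)))))
        Z-column : ∀ p q → p ≢ i → Z p q ≡ Q⟨ i ⟩ p q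
        Z-column p q p≢i = trans (Z-off p q (inj₁ p≢i)) Y-column
          where
            outer : p ≡ 0 ⊎ suc jm < p → Y p q ≡ Q⟨ i ⟩ p q
            outer out = trans (W.outer p q out) (trans (X₁-off p q (inj₁ p≢i))
                          (sym (Q⟨⟩-zero-r i p q ≤-refl i≤k (Q-outer p k ([ inj₁ , (λ j<p → inj₂ (subst (_< p) j≡i j<p)) ]′ out)))))
            Y-column : Y p q ≡ Q⟨ i ⟩ p q
            Y-column = [ (λ out → outer ([ inj₁ , (λ jm<p → inj₂ (≤∧≢⇒< jm<p (λ j≡p → p≢i (trans (sym j≡p) j≡i)))) ]′ out))
                       , (λ { (1≤p , p≤jm) → W.done p q 1≤p p≤jm }) ]′ (column-position jm p)

  sweep-top : ∀ d → suc d + t ≡ i → ∃ λ Z → columnSweep (suc d) R ≡ just Z × Z ≋ Q⟨ i ⟩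
  sweep-top d j≡i = Z , sweep-R , proj₂ (proj₂ finished)
    where
      open SweepTop (d + t) j≡i
      inner = sweep d (subst (d + t <_) j≡i ≤-refl) ready₁
      Y = proj₁ inner
      finished = finish (proj₂ (proj₂ inner))
      Z = proj₁ finished
      sweep-R : columnSweep (suc d) R ≡ just Z
      sweep-R = begin
        columnSweep (suc d) R                                      ≡⟨ cong (λ x → fφ x R >>= λ Y′ → columnSweep d Y′ >>= eε- x (r x)) j≡i ⟩
        (fφ i R >>= λ Y′ → columnSweep d Y′ >>= eε- i (r i))       ≡⟨ cong (_>>= λ Y′ → columnSweep d Y′ >>= eε- i (r i)) fφ-R ⟩
        (columnSweep d X₁ >>= eε- i (r i))                         ≡⟨ cong (_>>= eε- i (r i)) (proj₁ (proj₂ inner)) ⟩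
        eε- i (r i) Y                                              ≡⟨ proj₁ (proj₂ finished) ⟩
        just Z                                                     ∎
        where open ≡-Reasoning

  sweep-EF : ∃ λ Z → columnSweep (i ∸ t) R ≡ just Z × Z ≋ Q⟨ i ⟩
  sweep-EF with i ∸ t in i-t
  ... | zero  = sweep-t≡i (≤-antisym t≤i (m∸n≡0⇒m≤n i-t))
  ... | suc d = sweep-top d (trans (cong (_+ t) (sym i-t)) (m∸n+n≡m t≤i))

  private
    S-i>0 : 0 < S i
    S-i>0 = <-≤-trans (n≢0⇒n>0 Qtk≢0) (term≤Σ 1 i r t 1≤t t≤i)

  shiftRow : ∀ ℓ′ {Z} → i ≤ ℓ′ → suc ℓ′ ≤ k → Z ≋ Q⟨ ℓ′ ⟩ → ∃ λ C → fφ (suc ℓ′) Z ≡ just C × C ≋ Q⟨ suc ℓ′ ⟩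
  shiftRow ℓ′ {Z} i≤ℓ′ ℓ<k Z≋ = C , proj₁ (proj₂ shifted) , C≋
    where
      open RowPair n i m ℓ′ i≤ℓ′
      pos : 0 < rowSum Z ℓ′
      pos = subst (0 <_) (sym (Σ-cong 1 i _ (λ x _ _ → trans (Z≋ x ℓ′) (Q⟨⟩-at ℓ′ x)))) S-i>0
      separated : Separated Z i
      separated = record
        { c≤i = ≤-refl
        ; upperLeft = λ x i<x x≤i → ⊥-elim (<-irrefl refl (<-≤-trans i<x x≤i))
        ; lowerRight = λ x _ _ → trans (Z≋ x (suc ℓ′)) (trans (Q⟨⟩-off ℓ′ x (suc ℓ′) ℓ+1≢ℓ) (R-rows≤k x (suc ℓ′) (m≤n⇒m≤1+n i≤ℓ′) ℓ<k)) }
        where ℓ+1≢ℓ = λ e → <-irrefl (sym e) ≤-refl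
      shifted = fφ-above pos separated
      C = proj₁ shifted
      open RowMoved (proj₂ (proj₂ shifted))
      ℓ = suc ℓ′
      ℓ′≢ℓ : ℓ′ ≢ ℓ
      ℓ′≢ℓ e = <-irrefl e ≤-refl
      R-ℓ′ : ∀ x → R x ℓ′ ≡ 0
      R-ℓ′ x = R-rows≤k x ℓ′ i≤ℓ′ (<⇒≤ ℓ<k)
      R-ℓ : ∀ x → R x ℓ ≡ 0
      R-ℓ x = R-rows≤k x ℓ (m≤n⇒m≤1+n i≤ℓ′) ℓ<k
      inner : ∀ x y → 1 ≤ x → x ≤ i → C x y ≡ Q⟨ ℓ ⟩ x y
      inner x y 1≤x x≤i = agree-split₂ ℓ′ ℓ {C x} {Q⟨ ℓ ⟩ x}
        (trans (emptied x 1≤x x≤i) (sym (trans (Q⟨⟩-off ℓ x ℓ′ ℓ′≢ℓ) (R-ℓ′ x))))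
        (begin
          C x ℓ                    ≡⟨ cong (_+ C x ℓ) (emptied x 1≤x x≤i) ⟨
          C x ℓ′ + C x ℓ           ≡⟨ columnTotal x ⟩
          Z x ℓ′ + Z x ℓ           ≡⟨ cong₂ _+_ (trans (Z≋ x ℓ′) (Q⟨⟩-at ℓ′ x)) (trans (Z≋ x ℓ) (trans (Q⟨⟩-off ℓ′ x ℓ (λ e → ℓ′≢ℓ (sym e))) (R-ℓ x))) ⟩
          r x + 0                  ≡⟨ +-identityʳ (r x) ⟩
          r x                      ≡⟨ Q⟨⟩-at ℓ x ⟨
          Q⟨ ℓ ⟩ x ℓ               ∎)
        (λ y y≢ℓ′ y≢ℓ → trans (otherRows x y y≢ℓ′ y≢ℓ) (trans (Z≋ x y) (trans (Q⟨⟩-off ℓ′ x y y≢ℓ′) (sym (Q⟨⟩-off ℓ x y y≢ℓ)))))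
        y
        where open ≡-Reasoning
      C≋ : C ≋ Q⟨ ℓ ⟩
      C≋ x y = [ (λ out → trans (outerColumns x y out) (trans (Z≋ x y) (trans (Q⟨⟩-outer ℓ′ x y out) (sym (Q⟨⟩-outer ℓ x y out)))))
               , (λ { (1≤x , x≤i) → inner x y 1≤x x≤i }) ]′ (column-position i x)

  shiftRows : ∀ d ℓ′ {Z} → d + ℓ′ ≡ k → i ≤ ℓ′ → Z ≋ Q⟨ ℓ′ ⟩ → ∃ λ K → runSeq fφ (countUp (suc ℓ′) d) Z ≡ just K × K ≋ Q
  shiftRows zero    ℓ′ {Z} ℓ′≡k _ Z≋ = Z , refl , λ x y → trans (Z≋ x y) (trans (cong (λ ℓ → Q⟨ ℓ ⟩ x y) ℓ′≡k) (Q⟨k⟩≋Q x y))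
  shiftRows (suc d) ℓ′ {Z} d+ℓ≡k i≤ℓ′ Z≋ = K , trans (cong (_>>= runSeq fφ (countUp (suc (suc ℓ′)) d)) (proj₁ (proj₂ shifted))) (proj₁ (proj₂ rest)) , proj₂ (proj₂ rest)
    where
      shifted = shiftRow ℓ′ i≤ℓ′ (subst (suc ℓ′ ≤_) d+ℓ≡k (s≤s (m≤n+m ℓ′ d))) Z≋
      rest = shiftRows d (suc ℓ′) (trans (+-suc d ℓ′) d+ℓ≡k) (m≤n⇒m≤1+n i≤ℓ′) (proj₂ (proj₂ shifted))
      K = proj₁ rest

  private
    eφ : ℕ → Arr → Maybe Arr
    eφ j = eε- j (r j)

  EF-columnSweep : ∀ d X → ((runSeq fφ (reverse (countUp (suc t) d)) X >>= iter (f t) (r t)) >>= runSeq eφ (countUp (suc t) d))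
                           ≡ columnSweep d X
  EF-columnSweep zero    X = >>=-just (iter (f t) (r t) X)
  EF-columnSweep (suc d) X = begin
    ((runSeq fφ (reverse (countUp (suc t) (suc d))) X >>= iter (f t) (r t)) >>= runSeq eφ (countUp (suc t) (suc d)))
      ≡⟨ cong₂ (λ L₁ L₂ → (runSeq fφ L₁ X >>= iter (f t) (r t)) >>= runSeq eφ L₂)
               (trans (cong reverse (countUp-suc (suc t) d)) (reverse-++ xs (j ∷ []))) (countUp-suc (suc t) d) ⟩
    (((fφ j X >>= runSeq fφ (reverse xs)) >>= iter (f t) (r t)) >>= runSeq eφ (xs ++ j ∷ []))
      ≡⟨ cong (_>>= runSeq eφ (xs ++ j ∷ [])) (>>=-assoc (fφ j X) (runSeq fφ (reverse xs)) (iter (f t) (r t))) ⟩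
    ((fφ j X >>= λ Y → runSeq fφ (reverse xs) Y >>= iter (f t) (r t)) >>= runSeq eφ (xs ++ j ∷ []))
      ≡⟨ >>=-assoc (fφ j X) (λ Y → runSeq fφ (reverse xs) Y >>= iter (f t) (r t)) (runSeq eφ (xs ++ j ∷ [])) ⟩
    (fφ j X >>= λ Y → (runSeq fφ (reverse xs) Y >>= iter (f t) (r t)) >>= runSeq eφ (xs ++ j ∷ []))
      ≡⟨ >>=-cong (fφ j X) inner ⟩
    (fφ j X >>= λ Y → columnSweep d Y >>= eφ j)
      ≡⟨ cong (λ x → fφ x X >>= λ Y → columnSweep d Y >>= eφ x) (+-suc d t) ⟩
    columnSweep (suc d) X ∎
    where
      open ≡-Reasoning
      xs = countUp (suc t) d
      j = d + suc t
      inner : ∀ Y → ((runSeq fφ (reverse xs) Y >>= iter (f t) (r t)) >>= runSeq eφ (xs ++ j ∷ [])) ≡ (columnSweep d Y >>= eφ j)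
      inner Y = begin
        ((runSeq fφ (reverse xs) Y >>= iter (f t) (r t)) >>= runSeq eφ (xs ++ j ∷ []))
          ≡⟨ >>=-cong (runSeq fφ (reverse xs) Y >>= iter (f t) (r t)) (λ W → trans (runSeq-++ eφ xs (j ∷ []) W) (>>=-cong (runSeq eφ xs W) (λ V → >>=-just (eφ j V)))) ⟩
        ((runSeq fφ (reverse xs) Y >>= iter (f t) (r t)) >>= λ W → runSeq eφ xs W >>= eφ j)
          ≡⟨ >>=-assoc (runSeq fφ (reverse xs) Y >>= iter (f t) (r t)) (runSeq eφ xs) (eφ j) ⟨
        (((runSeq fφ (reverse xs) Y >>= iter (f t) (r t)) >>= runSeq eφ xs) >>= eφ j)
          ≡⟨ cong (_>>= eφ j) (EF-columnSweep d Y) ⟩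
        (columnSweep d Y >>= eφ j) ∎

  K-reconstructs : ∃ λ K → Kmap n i m Q k t R ≡ just K × K ≋ Q
  K-reconstructs = K , (begin
    Kmap n i m Q k t R                                              ≡⟨ cong (λ M → M >>= Emap n i m Q k t >>= Hmap n i m Q k t) F≡ ⟩
    (columnFirst >>= Emap n i m Q k t >>= Hmap n i m Q k t)         ≡⟨ cong (_>>= Hmap n i m Q k t) EF≡ ⟩
    Hmap n i m Q k t Z                                              ≡⟨ trans (upSeq-runSeq (suc i) k fφ Z) (cong (λ L → runSeq fφ L Z) (range-countUp (suc i) k)) ⟩
    runSeq fφ (countUp (suc i) (k ∸ i)) Z                           ≡⟨ proj₁ (proj₂ shifted) ⟩
    just K                                                          ∎) , proj₂ (proj₂ shifted)
    where
      open ≡-Reasoning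
      Z = proj₁ sweep-EF
      xs = countUp (suc t) (i ∸ t)
      columnFirst = runSeq fφ (reverse xs) R >>= iter (f t) (r t)
      F≡ : Fmap n i m Q k t R ≡ columnFirst
      F≡ = cong (_>>= iter (f t) (r t)) (trans (downSeq-runSeq (suc t) i fφ R) (cong (λ L → runSeq fφ (reverse L) R) (range-countUp (suc t) i)))
      EF≡ : (columnFirst >>= Emap n i m Q k t) ≡ just Z
      EF≡ = trans (>>=-cong columnFirst (λ B → trans (upSeq-runSeq (suc t) i eφ B) (cong (λ L → runSeq eφ L B) (range-countUp (suc t) i))))
                  (trans (EF-columnSweep (i ∸ t) R) (proj₁ (proj₂ sweep-EF)))
      shifted = shiftRows (k ∸ i) i (m∸n+n≡m i≤k) ≤-refl (proj₂ (proj₂ sweep-EF))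
      K = proj₁ shifted

-- The hypotheses discarded below (1 ≤ n, 1 ≤ m, Q ≠ 0, row k of Q non-zero) follow from the others.
theorem3p1 : (n i m : ℕ) → 1 ≤ n → 1 ≤ i → i ≤ n → 1 ≤ m →
    (Q : Arr) → InB n i m Q →
    (∃ λ p → ∃ λ q → InRange n i p q × Q p q ≢ 0) →
    (k : ℕ) → i ≤ k → k ≤ n →
    (∃ λ p → 1 ≤ p × p ≤ i × Q p k ≢ 0) →
    (∀ q → i ≤ q → q < k → ∀ p → Q p q ≡ 0) →
    (t : ℕ) → 1 ≤ t → t ≤ i → Q t k ≢ 0 →
    (∀ p → 1 ≤ p → p < t → Q p k ≡ 0) →
    Σ Arr λ K → (Kmap n i m Q k t (zeroRow Q k) ≡ just K) × (∀ p q → K p q ≡ Q p q)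
theorem3p1 n i m _ 1≤i i≤n _ Q Q∈B _ k i≤k k≤n _ rowsAbove t 1≤t t≤i Qtk≢0 leftOf-t =
  Setting.K-reconstructs n i m 1≤i i≤n Q Q∈B k i≤k k≤n rowsAbove t 1≤t t≤i Qtk≢0 leftOf-t
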